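{- For all sufficiently large $n$, there exists a good base $\mathcal{R}$ over $n$-bit strings of size $m=O(n^3\log n)$ and real polynomials $q_{(r,i)}:\{0,1\}^m\to\mathbb{R}$, for $r\in\mathcal{R}$ and $i\in\{0,1\}^n$, each of degree at most $O(\log n)$, such that $$\Pr_{r\leftarrow\mathcal{R}}\Big[\exists i,x\in\{0,1\}^n:\ \big|q_{(r,i)}(\mathcal{Y}(r,x))-\mathsf{GT}_i(x)\big|>\tfrac16\Big]<\frac13,$$ where $r$ is drawn uniformly from $\mathcal{R}$.
   Context: For $\tau\in\{0,1\}^n$ let $\mathcal{R}^\tau=\{v\in\{0,1\}^n: v_k=0 \text{ for every } k \text{ with } \tau_k=0\}$. Let $\mathbf{1}_j\in\{0,1\}^n$ be the string with a 1 in position $j$ and 0 elsewhere. A good base of size $m=n+m'$ is a set of the form $\mathcal{R}=\{\mathbf{1}_1\}\times\cdots\times\{\mathbf{1}_n\}\times\mathcal{R}^{\tau^{(1)}}\times\cdots\times\mathcal{R}^{\tau^{(m')}}$ for some templates $\tau^{(1)},\dots,\tau^{(m')}\in\{0,1\}^n$; an element is an $m$-tuple $r=(r_1,\dots,r_m)$ of $n$-bit strings, and sampling $r$ uniformly means each $r_{n+j}$ is uniform on $\mathcal{R}^{\tau^{(j)}}$, independently. For $r\in\mathcal{R}$, $x\in\{0,1\}^n$, $\mathcal{Y}(r,x)\in\{0,1\}^m$ has $\mathcal{Y}(r,x)_j=\langle r_j,x\rangle\bmod 2$. For $i\in\{0,1\}^n$, $\mathsf{GT}_i:\{0,1\}^n\to\{0,1\}$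 is $\mathsf{GT}_i(x)=1$ iff $x\le i$ when $x,i$ are compared as numbers written in binary. Logarithms are base 2. -}

module Defs where

open import Data.Bool using (Bool; true; false; _∧_; _∨_; _xor_; not; if_then_else_)
open import Data.Nat as ℕ using (ℕ; zero; suc; _≤ᵇ_)
open import Data.Fin using (Fin; _≟_)
open import Data.Fin.Subset using (Subset) renaming (∣_∣ to size)
open import Data.Vec using (Vec; []; _∷_; tabulate; zipWith; foldr; _++_)
import Data.Vec as Vec
open import Data.List using (List; [_]; map; concatMap; filter; length)
open import Data.Bool.ListAction using (any)
import Data.List as List
open import Data.Product using (_×_; _,_)
open import Data.Integer using (+_)
open import Data.Rational using (ℚ; 0ℚ; 1ℚ; _/_; _-_; _*_; _+_; ∣_∣; _<_)
open import Data.Rational.Properties using (_<?_)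
open import Relation.Nullary using (does)

-- n-bit strings; position 1 of the paper is index zero (the head)
BitStr : ℕ → Set
BitStr n = Vec Bool n

allBits : (n : ℕ) → List (BitStr n)
allBits zero = [ [] ]
allBits (suc n) = map (false ∷_) (allBits n) List.++ map (true ∷_) (allBits n)

-- R^τ = { v : v_k = 0 whenever τ_k = 0 }, listed without repetition
R^ : {n : ℕ} → BitStr n → List (BitStr n)
R^ [] = [ [] ]
R^ (false ∷ τ) = map (false ∷_) (R^ τ)
R^ (true ∷ τ) = map (false ∷_) (R^ τ) List.++ map (true ∷_) (R^ τ)

unitVec : {n : ℕ} → Fin n → BitStr n
unitVec j = tabulate (λ k → does (j ≟ k))

units : (n : ℕ) → Vec (BitStr n) n
units n = tabulate unitVec

products : {n m' : ℕ} → Vec (BitStr n) m' → List (Vec (BitStr n) m')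
products [] = [ [] ]
products (τ ∷ τs) = concatMap (λ v → map (v ∷_) (products τs)) (R^ τ)

-- the good base {1_1} × ... × {1_n} × R^{τ(1)} × ... × R^{τ(m')},
-- listed without repetition (uniform sampling = uniform over this list)
goodBase : {n m' : ℕ} → Vec (BitStr n) m' → List (Vec (BitStr n) (n ℕ.+ m'))
goodBase {n} τs = map (units n ++_) (products τs)

dot : {n : ℕ} → BitStr n → BitStr n → Bool
dot r x = foldr (λ _ → Bool) _xor_ false (zipWith _∧_ r x)

Y : {n m : ℕ} → Vec (BitStr n) m → BitStr n → BitStr m
Y r x = Vec.map (λ rj → dot rj x) r

-- value of a bit string as a binary number, head = most significant bit
val : {n : ℕ} → BitStr n → ℕ
val {suc n} (b ∷ bs) = (if b then 2 ℕ.^ n else 0) ℕ.+ val bs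
val {zero} [] = 0

GT : {n : ℕ} → BitStr n → BitStr n → ℚ
GT i x = if val x ≤ᵇ val i then 1ℚ else 0ℚ

-- Polynomials on {0,1}^m with rational coefficients, as a finite list of
-- (coefficient, monomial) where a monomial is the set of variables in it
-- (on {0,1}^m, y_k^2 = y_k, so multilinear monomials suffice).
Poly : ℕ → Set
Poly m = List (ℚ × Subset m)

bitℚ : Bool → ℚ
bitℚ true = 1ℚ
bitℚ false = 0ℚ

monomial : {m : ℕ} → Subset m → BitStr m → ℚ
monomial S y = foldr (λ _ → ℚ) _*_ 1ℚ (zipWith (λ s b → if s then bitℚ b else 1ℚ) S y)

eval : {m : ℕ} → Poly m → BitStr m → ℚ
eval p y = List.foldr _+_ 0ℚ (map (λ { (c , S) → c * monomial S y }) p)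

DegreeAtMost : {m : ℕ} → ℕ → Poly m → Set
DegreeAtMost d p = Data.List.Relation.Unary.All.All (λ { (c , S) → size S ℕ.≤ d }) p
  where import Data.List.Relation.Unary.All

oneSixth : ℚ
oneSixth = + 1 / 6

bad : {n m : ℕ} → (Vec (BitStr n) m → BitStr n → Poly m) → Vec (BitStr n) m → Bool
bad {n} q r = any (λ i → any (λ x →
  does (oneSixth <? ∣ eval (q r i) (Y r x) - GT i x ∣)) (allBits n)) (allBits n)

badCount : {n m' : ℕ} → Vec (BitStr n) m' →
           (Vec (BitStr n) (n ℕ.+ m') → BitStr n → Poly (n ℕ.+ m')) → ℕ
badCount τs q = length (List.filter (λ r → Relation.Nullary.Decidable.T? (bad q r)) (goodBase τs))
  where import Relation.Nullary.Decidable

-- GT_i(x) = Σ_{k ≤ n} A_k · S_k, where A_k = [x and i agree on their first k bits] and S_k is [i_k = 1 ∧ x_k = 0]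
-- for k < n and 1 for k = n; S_k is affine in x, which Y(r, x) contains thanks to the units 1_j.
-- For each k the base takes L = 4t samples from R^τ with τ = 1^k 0^(n-k). With w = x ⊕ i, the number c_k of these
-- samples v with ⟨v, w⟩ = 1 is affine in Y(r, x), since ⟨v, w⟩ = ⟨v, x⟩ ⊕ ⟨v, i⟩. If A_k = 1 then c_k = 0;
-- otherwise ⟨·, w⟩ is balanced on R^τ, so E[3^c_k] = 2^L and by Markov's inequality c_k ∈ [t, 3t] except with
-- probability 2 (16/27)^t. When this holds for all k and w, E_k = 1 - c_k/(2t) satisfies |E_k^p - A_k| ≤ 2^-p, so
-- q = Σ_k E_k^p S_k has degree p + 1 and error at most (n + 1) 2^-p ≤ 1/6 for p = ⌈log₂ n⌉ + 4. A union bound over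
-- the n + 1 blocks and the 2^n strings w, with t = 3n, bounds the probability of failure by 1/3.

module Submission where

open import Data.Nat using (ℕ; NonZero)

module Counting where
  open import Data.Bool using (Bool; true; false; if_then_else_; T; _∨_)
  open import Data.Bool.ListAction using (any)
  open import Data.Nat
  open import Data.Nat.Properties
  open import Data.List using (List; []; _∷_; map; concatMap; length; filter; _++_)
  import Data.List.Properties as List
  open import Data.Vec using (Vec) renaming (_∷_ to _∷ᵥ_)
  open import Data.Empty using (⊥-elim)
  open import Relation.Binary.PropositionalEquality
  open import Relation.Nullary.Decidable using (T?)

  private variable
    A B : Set

  count : (A → Bool) → List A → ℕ
  count P [] = 0
  count P (x ∷ xs) = if P x then suc (count P xs) else count P xs

  sumMap : (A → ℕ) → List A → ℕ
  sumMap f [] = 0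
  sumMap f (x ∷ xs) = f x + sumMap f xs

  length-filter-T? : (P : A → Bool) (xs : List A) → length (filter (λ x → T? (P x)) xs) ≡ count P xs
  length-filter-T? P [] = refl
  length-filter-T? P (x ∷ xs) with P x
  ... | true = cong suc (length-filter-T? P xs)
  ... | false = length-filter-T? P xs

  count-map : (P : B → Bool) (f : A → B) (xs : List A) → count P (map f xs) ≡ count (λ a → P (f a)) xs
  count-map P f [] = refl
  count-map P f (x ∷ xs) with P (f x)
  ... | true = cong suc (count-map P f xs)
  ... | false = count-map P f xs

  count-++ : (P : A → Bool) (xs ys : List A) → count P (xs ++ ys) ≡ count P xs + count P ys
  count-++ P [] ys = refl
  count-++ P (x ∷ xs) ys with P x
  ... | true = cong suc (count-++ P xs ys)
  ... | false = count-++ P xs ys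

  count-true : (xs : List A) → count (λ _ → true) xs ≡ length xs
  count-true [] = refl
  count-true (x ∷ xs) = cong suc (count-true xs)

  count-false : (xs : List A) → count (λ _ → false) xs ≡ 0
  count-false [] = refl
  count-false (x ∷ xs) = count-false xs

  count-mono : (P Q : A → Bool) → (∀ a → T (P a) → T (Q a)) → (xs : List A) → count P xs ≤ count Q xs
  count-mono P Q P⇒Q [] = z≤n
  count-mono P Q P⇒Q (x ∷ xs) with P x in Px | Q x in Qx
  ... | true  | true  = s≤s (count-mono P Q P⇒Q xs)
  ... | false | true  = m≤n⇒m≤1+n (count-mono P Q P⇒Q xs)
  ... | false | false = count-mono P Q P⇒Q xs
  ... | true  | false = ⊥-elim (subst T Qx (P⇒Q x (subst T (sym Px) _)))

  count-∨ : (P Q : A → Bool) (xs : List A) → count (λ x → P x ∨ Q x) xs ≤ count P xs + count Q xs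
  count-∨ P Q [] = z≤n
  count-∨ P Q (x ∷ xs) with P x | Q x
  ... | true  | true  = s≤s (≤-trans (count-∨ P Q xs) (+-monoʳ-≤ (count P xs) (n≤1+n (count Q xs))))
  ... | true  | false = s≤s (count-∨ P Q xs)
  ... | false | true  = ≤-trans (s≤s (count-∨ P Q xs)) (≤-reflexive (sym (+-suc (count P xs) (count Q xs))))
  ... | false | false = count-∨ P Q xs

  count-any : (P : B → A → Bool) (bs : List B) (xs : List A) →
    count (λ x → any (λ b → P b x) bs) xs ≤ sumMap (λ b → count (P b) xs) bs
  count-any P [] xs = ≤-reflexive (count-false xs)
  count-any P (b ∷ bs) xs =
    ≤-trans (count-∨ (P b) (λ x → any (λ b → P b x) bs) xs) (+-monoʳ-≤ (count (P b) xs) (count-any P bs xs))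

  sumMap-++ : (f : A → ℕ) (xs ys : List A) → sumMap f (xs ++ ys) ≡ sumMap f xs + sumMap f ys
  sumMap-++ f [] ys = refl
  sumMap-++ f (x ∷ xs) ys = trans (cong (f x +_) (sumMap-++ f xs ys)) (sym (+-assoc (f x) _ _))

  sumMap-map : (f : B → ℕ) (g : A → B) (xs : List A) → sumMap f (map g xs) ≡ sumMap (λ a → f (g a)) xs
  sumMap-map f g [] = refl
  sumMap-map f g (x ∷ xs) = cong (f (g x) +_) (sumMap-map f g xs)

  sumMap-cong : {f g : A → ℕ} → (∀ a → f a ≡ g a) → (xs : List A) → sumMap f xs ≡ sumMap g xs
  sumMap-cong f≡g [] = refl
  sumMap-cong f≡g (x ∷ xs) = cong₂ _+_ (f≡g x) (sumMap-cong f≡g xs)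

  sumMap-mono-≤ : {f g : A → ℕ} → (∀ a → f a ≤ g a) → (xs : List A) → sumMap f xs ≤ sumMap g xs
  sumMap-mono-≤ f≤g [] = z≤n
  sumMap-mono-≤ f≤g (x ∷ xs) = +-mono-≤ (f≤g x) (sumMap-mono-≤ f≤g xs)

  sumMap-+ : (f g : A → ℕ) (xs : List A) → sumMap (λ a → f a + g a) xs ≡ sumMap f xs + sumMap g xs
  sumMap-+ f g [] = refl
  sumMap-+ f g (x ∷ xs) =
    trans (cong (f x + g x +_) (sumMap-+ f g xs)) (interchange (f x) (g x) (sumMap f xs) (sumMap g xs))
    where open import Algebra.Properties.CommutativeSemigroup +-commutativeSemigroup using (interchange)

  sumMap-*ʳ : (f : A → ℕ) (c : ℕ) (xs : List A) → sumMap (λ a → f a * c) xs ≡ sumMap f xs * c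
  sumMap-*ʳ f c [] = refl
  sumMap-*ʳ f c (x ∷ xs) = trans (cong (f x * c +_) (sumMap-*ʳ f c xs)) (sym (*-distribʳ-+ c (f x) (sumMap f xs)))

  sumMap-*ˡ : (f : A → ℕ) (c : ℕ) (xs : List A) → sumMap (λ a → c * f a) xs ≡ c * sumMap f xs
  sumMap-*ˡ f c [] = sym (*-zeroʳ c)
  sumMap-*ˡ f c (x ∷ xs) = trans (cong (c * f x +_) (sumMap-*ˡ f c xs)) (sym (*-distribˡ-+ c (f x) (sumMap f xs)))

  sumMap-const : (c : ℕ) (xs : List A) → sumMap (λ _ → c) xs ≡ length xs * c
  sumMap-const c [] = refl
  sumMap-const c (x ∷ xs) = cong (c +_) (sumMap-const c xs)

  ^-distribʳ-* : ∀ a b o → (a * b) ^ o ≡ a ^ o * b ^ o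
  ^-distribʳ-* a b zero = refl
  ^-distribʳ-* a b (suc o) = trans (cong (a * b *_) (^-distribʳ-* a b o)) (interchange a b (a ^ o) (b ^ o))
    where open import Algebra.Properties.CommutativeSemigroup *-commutativeSemigroup using (interchange)

  markov : (b a : ℕ) .{{_ : NonZero b}} (f : A → ℕ) (xs : List A) →
    count (λ x → a ≤ᵇ f x) xs * b ^ a ≤ sumMap (λ x → b ^ f x) xs
  markov b a f [] = z≤n
  markov b a f (x ∷ xs) with a ≤ᵇ f x in a≤fx
  ... | true  = +-mono-≤ (^-monoʳ-≤ b (≤ᵇ⇒≤ a (f x) (subst T (sym a≤fx) _))) (markov b a f xs)
  ... | false = ≤-trans (markov b a f xs) (m≤n+m _ (b ^ f x))

  length-concatMap-∷ : ∀ {m} (vs : List A) (ss : List (Vec A m)) →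
    length (concatMap (λ v → map (v ∷ᵥ_) ss) vs) ≡ length vs * length ss
  length-concatMap-∷ [] ss = refl
  length-concatMap-∷ (v ∷ vs) ss =
    trans (List.length-++ (map (v ∷ᵥ_) ss)) (cong₂ _+_ (List.length-map (v ∷ᵥ_) ss) (length-concatMap-∷ vs ss))

  count-concatMap-∷ : ∀ {m} (P : Vec A (suc m) → Bool) (vs : List A) (ss : List (Vec A m)) →
    count P (concatMap (λ v → map (v ∷ᵥ_) ss) vs) ≡ sumMap (λ v → count (λ s → P (v ∷ᵥ s)) ss) vs
  count-concatMap-∷ P [] ss = refl
  count-concatMap-∷ P (v ∷ vs) ss =
    trans (count-++ P (map (v ∷ᵥ_) ss) _) (cong₂ _+_ (count-map P (v ∷ᵥ_) ss) (count-concatMap-∷ P vs ss))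

  sumMap-concatMap-∷ : ∀ {m} (f : Vec A (suc m) → ℕ) (vs : List A) (ss : List (Vec A m)) →
    sumMap f (concatMap (λ v → map (v ∷ᵥ_) ss) vs) ≡ sumMap (λ v → sumMap (λ s → f (v ∷ᵥ s)) ss) vs
  sumMap-concatMap-∷ f [] ss = refl
  sumMap-concatMap-∷ f (v ∷ vs) ss =
    trans (sumMap-++ f (map (v ∷ᵥ_) ss) _) (cong₂ _+_ (sumMap-map f (v ∷ᵥ_) ss) (sumMap-concatMap-∷ f vs ss))

  record AtMostFraction (e d : ℕ) (P : A → Bool) (xs : List A) : Set where
    constructor atMostFraction
    field bound : d * count P xs ≤ e * length xs

  atMostFraction-mono : ∀ {e d} {P Q : A → Bool} {xs} → (∀ a → T (P a) → T (Q a)) →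
    AtMostFraction e d Q xs → AtMostFraction e d P xs
  atMostFraction-mono {d = d} {P} {Q} {xs} P⇒Q (atMostFraction h) = atMostFraction (≤-trans (*-monoʳ-≤ d (count-mono P Q P⇒Q xs)) h)

  atMostFraction-weaken : ∀ {e e′ d} {P : A → Bool} {xs} → e ≤ e′ → AtMostFraction e d P xs → AtMostFraction e′ d P xs
  atMostFraction-weaken {xs = xs} e≤e′ (atMostFraction h) = atMostFraction (≤-trans h (*-monoˡ-≤ (length xs) e≤e′))

  atMostFraction-∨ : ∀ {e e′ d} {P Q : A → Bool} {xs} → AtMostFraction e d P xs → AtMostFraction e′ d Q xs →
    AtMostFraction (e + e′) d (λ x → P x ∨ Q x) xs
  atMostFraction-∨ {e = e} {e′} {d} {P} {Q} {xs} (atMostFraction hP) (atMostFraction hQ) = atMostFraction (begin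
    d * count (λ x → P x ∨ Q x) xs     ≤⟨ *-monoʳ-≤ d (count-∨ P Q xs) ⟩
    d * (count P xs + count Q xs)      ≡⟨ *-distribˡ-+ d (count P xs) (count Q xs) ⟩
    d * count P xs + d * count Q xs    ≤⟨ +-mono-≤ hP hQ ⟩
    e * length xs + e′ * length xs     ≡⟨ *-distribʳ-+ (length xs) e e′ ⟨
    (e + e′) * length xs               ∎)
    where open ≤-Reasoning

  atMostFraction-any : ∀ {e d} (P : B → A → Bool) (bs : List B) {xs} → (∀ b → AtMostFraction e d (P b) xs) →
    AtMostFraction (length bs * e) d (λ x → any (λ b → P b x) bs) xs
  atMostFraction-any {e = e} {d} P bs {xs} h = atMostFraction (begin
    d * count (λ x → any (λ b → P b x) bs) xs ≤⟨ *-monoʳ-≤ d (count-any P bs xs) ⟩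
    d * sumMap (λ b → count (P b) xs) bs      ≡⟨ sumMap-*ˡ _ d bs ⟨
    sumMap (λ b → d * count (P b) xs) bs      ≤⟨ sumMap-mono-≤ (λ b → AtMostFraction.bound (h b)) bs ⟩
    sumMap (λ _ → e * length xs) bs           ≡⟨ sumMap-const _ bs ⟩
    length bs * (e * length xs)               ≡⟨ *-assoc (length bs) e _ ⟨
    length bs * e * length xs                 ∎)
    where open ≤-Reasoning

  atMostFraction-scale : ∀ {e d} {P : A → Bool} {Q : B → Bool} {xs ys} l →
    count Q ys ≡ count P xs * l → length ys ≡ length xs * l →
    AtMostFraction e d P xs → AtMostFraction e d Q ys
  atMostFraction-scale {e = e} {d} {P} {Q} {xs} {ys} l count≡ length≡ (atMostFraction h) = atMostFraction (begin
    d * count Q ys       ≡⟨ cong (d *_) count≡ ⟩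
    d * (count P xs * l) ≡⟨ *-assoc d _ l ⟨
    d * count P xs * l   ≤⟨ *-monoˡ-≤ l h ⟩
    e * length xs * l    ≡⟨ *-assoc e _ l ⟩
    e * (length xs * l)  ≡⟨ cong (e *_) length≡ ⟨
    e * length ys        ∎)
    where open ≤-Reasoning

  atMostFraction⇒count< : ∀ {e d} {P : A → Bool} {xs} c → c * e < d → 0 < length xs →
    AtMostFraction e d P xs → c * count P xs < length xs
  atMostFraction⇒count< {e = e} {d} {P} {xs} c ce<d 0<len (atMostFraction h) = *-cancelˡ-< d _ _ (begin-strict
    d * (c * count P xs) ≡⟨ x∙yz≈y∙xz d c _ ⟩
    c * (d * count P xs) ≤⟨ *-monoʳ-≤ c h ⟩
    c * (e * length xs)  ≡⟨ *-assoc c e _ ⟨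
    c * e * length xs    <⟨ *-monoˡ-< (length xs) {{>-nonZero 0<len}} ce<d ⟩
    d * length xs        ∎)
    where open ≤-Reasoning
          open import Algebra.Properties.CommutativeSemigroup *-commutativeSemigroup using (x∙yz≈y∙xz)

module Products where
  open import Data.Bool using (Bool; true; false)
  open import Data.Nat
  open import Data.Nat.Properties
  open import Data.Fin using (Fin; zero; suc; combine)
  open import Data.List using (List; length; map; _++_)
  import Data.List.Properties as List
  open import Data.Vec using (Vec; []; _∷_; take; drop; concat; lookup; replicate) renaming (_++_ to _++ᵥ_)
  import Data.Vec.Properties as Vec
  open import Relation.Binary.PropositionalEquality
  open import Defs using (BitStr; R^; products)
  open Counting

  private variable
    n : ℕ

  count-products-take : ∀ {a b} (τs : Vec (BitStr n) a) (σs : Vec (BitStr n) b) (P : Vec (BitStr n) a → Bool) →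
    count (λ s → P (take a s)) (products (τs ++ᵥ σs)) ≡ count P (products τs) * length (products σs)
  count-products-take [] σs P with P []
  ... | true  = trans (count-true (products σs)) (sym (+-identityʳ _))
  ... | false = count-false (products σs)
  count-products-take {a = suc a} (τ ∷ τs) σs P = begin
    count (λ s → P (take (suc a) s)) (products (τ ∷ τs ++ᵥ σs))
      ≡⟨ count-concatMap-∷ (λ s → P (take (suc a) s)) (R^ τ) _ ⟩
    sumMap (λ v → count (λ s → P (v ∷ take a s)) (products (τs ++ᵥ σs))) (R^ τ)
      ≡⟨ sumMap-cong (λ v → count-products-take τs σs (λ u → P (v ∷ u))) (R^ τ) ⟩
    sumMap (λ v → count (λ u → P (v ∷ u)) (products τs) * length (products σs)) (R^ τ)
      ≡⟨ sumMap-*ʳ _ _ (R^ τ) ⟩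
    sumMap (λ v → count (λ u → P (v ∷ u)) (products τs)) (R^ τ) * length (products σs)
      ≡⟨ cong (_* length (products σs)) (count-concatMap-∷ P (R^ τ) (products τs)) ⟨
    count P (products (τ ∷ τs)) * length (products σs) ∎
    where open ≡-Reasoning

  length-products-++ : ∀ {a b} (τs : Vec (BitStr n) a) (σs : Vec (BitStr n) b) →
    length (products (τs ++ᵥ σs)) ≡ length (products τs) * length (products σs)
  length-products-++ τs σs = begin
    length (products (τs ++ᵥ σs))                          ≡⟨ count-true (products (τs ++ᵥ σs)) ⟨
    count (λ _ → true) (products (τs ++ᵥ σs))              ≡⟨ count-products-take τs σs (λ _ → true) ⟩
    count (λ _ → true) (products τs) * length (products σs) ≡⟨ cong (_* length (products σs)) (count-true (products τs)) ⟩
    length (products τs) * length (products σs)            ∎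
    where open ≡-Reasoning

  count-products-drop : ∀ {a b} (τs : Vec (BitStr n) a) (σs : Vec (BitStr n) b) (P : Vec (BitStr n) b → Bool) →
    count (λ s → P (drop a s)) (products (τs ++ᵥ σs)) ≡ count P (products σs) * length (products τs)
  count-products-drop [] σs P = sym (*-identityʳ _)
  count-products-drop {a = suc a} (τ ∷ τs) σs P = begin
    count (λ s → P (drop (suc a) s)) (products (τ ∷ τs ++ᵥ σs))
      ≡⟨ count-concatMap-∷ (λ s → P (drop (suc a) s)) (R^ τ) _ ⟩
    sumMap (λ v → count (λ s → P (drop a s)) (products (τs ++ᵥ σs))) (R^ τ)
      ≡⟨ sumMap-cong (λ v → count-products-drop τs σs P) (R^ τ) ⟩
    sumMap (λ v → count P (products σs) * length (products τs)) (R^ τ)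
      ≡⟨ sumMap-const _ (R^ τ) ⟩
    length (R^ τ) * (count P (products σs) * length (products τs))
      ≡⟨ x∙yz≈y∙xz (length (R^ τ)) (count P (products σs)) (length (products τs)) ⟩
    count P (products σs) * (length (R^ τ) * length (products τs))
      ≡⟨ cong (count P (products σs) *_) (length-concatMap-∷ (R^ τ) (products τs)) ⟨
    count P (products σs) * length (products (τ ∷ τs)) ∎
    where open ≡-Reasoning
          open import Algebra.Properties.CommutativeSemigroup *-commutativeSemigroup using (x∙yz≈y∙xz)

  blocks : ∀ {A : Set} N {L} → Vec A (N * L) → Vec (Vec A L) N
  blocks zero s = []
  blocks (suc N) {L} s = take L s ∷ blocks N (drop L s)

  concat-blocks : ∀ {A : Set} N {L} (s : Vec A (N * L)) → concat (blocks N s) ≡ s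
  concat-blocks zero [] = refl
  concat-blocks (suc N) {L} s = trans (cong (take L s ++ᵥ_) (concat-blocks N (drop L s))) (Vec.take++drop≡id L s)

  lookup-blocks : ∀ {A : Set} N {L} (s : Vec A (N * L)) k j → lookup (lookup (blocks N s) k) j ≡ lookup s (combine k j)
  lookup-blocks N s k j = trans (sym (Vec.lookup-concat (blocks N s) k j)) (cong (λ z → lookup z (combine k j)) (concat-blocks N s))

  atMostFraction-block : ∀ {L N e d} (τss : Vec (Vec (BitStr n) L) N) (k : Fin N) (P : Vec (BitStr n) L → Bool) →
    AtMostFraction e d P (products (lookup τss k)) →
    AtMostFraction e d (λ s → P (lookup (blocks N s) k)) (products (concat τss))
  atMostFraction-block (τs ∷ τss) zero P =
    atMostFraction-scale _ (count-products-take τs (concat τss) P) (length-products-++ τs (concat τss))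
  atMostFraction-block {N = suc N} (τs ∷ τss) (suc k) P h =
    atMostFraction-scale _ (count-products-drop τs (concat τss) (λ s → P (lookup (blocks N s) k)))
      (trans (length-products-++ τs (concat τss)) (*-comm (length (products τs)) _)) (atMostFraction-block τss k P h)

  length-products-replicate : ∀ (τ : BitStr n) L → length (products (replicate L τ)) ≡ length (R^ τ) ^ L
  length-products-replicate τ zero = refl
  length-products-replicate τ (suc L) =
    trans (length-concatMap-∷ (R^ τ) (products (replicate L τ))) (cong (length (R^ τ) *_) (length-products-replicate τ L))

  length-R^-positive : ∀ {k} (τ : BitStr k) → 0 < length (R^ τ)
  length-R^-positive [] = s≤s z≤n
  length-R^-positive (false ∷ τ) = ≤-trans (length-R^-positive τ) (≤-reflexive (sym (List.length-map (false ∷_) (R^ τ))))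
  length-R^-positive (true ∷ τ) = begin
    1                                                      ≤⟨ length-R^-positive τ ⟩
    length (R^ τ)                                          ≡⟨ List.length-map (false ∷_) (R^ τ) ⟨
    length (map (false ∷_) (R^ τ))                         ≤⟨ m≤m+n _ _ ⟩
    length (map (false ∷_) (R^ τ)) + length (map (true ∷_) (R^ τ)) ≡⟨ List.length-++ (map (false ∷_) (R^ τ)) ⟨
    length (R^ (true ∷ τ))                                 ∎
    where open ≤-Reasoning

  length-products-positive : ∀ {m} (τs : Vec (BitStr n) m) → 0 < length (products τs)
  length-products-positive [] = s≤s z≤n
  length-products-positive (τ ∷ τs) = begin
    1                                           ≤⟨ *-mono-≤ (length-R^-positive τ) (length-products-positive τs) ⟩
    length (R^ τ) * length (products τs)        ≡⟨ length-concatMap-∷ (R^ τ) (products τs) ⟨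
    length (products (τ ∷ τs))                  ∎
    where open ≤-Reasoning

module Deviation where
  open import Data.Bool using (Bool; true; false; not; _∧_; _∨_; if_then_else_; T)
  open import Data.Bool.Properties using (T-∨)
  open import Data.Empty using (⊥-elim)
  open import Data.Product using (_×_; _,_)
  open import Data.Sum using (inj₁; inj₂)
  open import Function.Bundles using (Equivalence)
  open import Relation.Nullary using (¬_)
  open import Data.Nat
  open import Data.Nat.Properties
  open import Data.List using (List; length; map; _++_)
  import Data.List.Properties as List
  open import Data.Vec using (Vec; []; _∷_; replicate)
  open import Data.Nat.Tactic.RingSolver using (solve-∀)
  open import Relation.Binary.PropositionalEquality
  open import Defs using (BitStr; R^; products; dot)
  open Counting
  open Products

  toℕ : Bool → ℕ
  toℕ true = 1
  toℕ false = 0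

  agree : Bool → Bool → Bool
  agree true d = d
  agree false d = not d

  disjoint : ∀ {n} → BitStr n → BitStr n → Bool
  disjoint [] [] = true
  disjoint (c ∷ w) (t ∷ τ) = not (c ∧ t) ∧ disjoint w τ

  parityCount : ∀ {n L} → Bool → BitStr n → Vec (BitStr n) L → ℕ
  parityCount b w [] = 0
  parityCount b w (v ∷ s) = toℕ (agree b (dot v w)) + parityCount b w s

  weight : ∀ {n} → ℕ → Bool → BitStr n → BitStr n → ℕ
  weight B b w v = B ^ toℕ (agree b (dot v w))

  sumMap-R^-true : ∀ {n} (f : BitStr (suc n) → ℕ) (τ : BitStr n) →
    sumMap f (R^ (true ∷ τ)) ≡ sumMap (λ v → f (false ∷ v)) (R^ τ) + sumMap (λ v → f (true ∷ v)) (R^ τ)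
  sumMap-R^-true f τ =
    trans (sumMap-++ f (map (false ∷_) (R^ τ)) _) (cong₂ _+_ (sumMap-map f (false ∷_) (R^ τ)) (sumMap-map f (true ∷_) (R^ τ)))

  length-R^-true : ∀ {n} (τ : BitStr n) → length (R^ (true ∷ τ)) ≡ length (R^ τ) + length (R^ τ)
  length-R^-true τ =
    trans (List.length-++ (map (false ∷_) (R^ τ))) (cong₂ _+_ (List.length-map (false ∷_) (R^ τ)) (List.length-map (true ∷_) (R^ τ)))

  disjoint-false-∷ : ∀ {n} c (w τ : BitStr n) → disjoint (c ∷ w) (false ∷ τ) ≡ disjoint w τ
  disjoint-false-∷ true w τ = refl
  disjoint-false-∷ false w τ = refl

  sumMap-weight-disjoint : ∀ {n} B (w τ : BitStr n) → disjoint w τ ≡ true →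
    sumMap (weight B true w) (R^ τ) ≡ length (R^ τ)
  sumMap-weight-disjoint B [] [] _ = refl
  sumMap-weight-disjoint B (c ∷ w) (false ∷ τ) disj = begin
    sumMap (weight B true (c ∷ w)) (map (false ∷_) (R^ τ)) ≡⟨ sumMap-map (weight B true (c ∷ w)) (false ∷_) (R^ τ) ⟩
    sumMap (weight B true w) (R^ τ)                       ≡⟨ sumMap-weight-disjoint B w τ (trans (sym (disjoint-false-∷ c w τ)) disj) ⟩
    length (R^ τ)                                         ≡⟨ List.length-map (false ∷_) (R^ τ) ⟨
    length (map (false ∷_) (R^ τ))                        ∎
    where open ≡-Reasoning
  sumMap-weight-disjoint B (false ∷ w) (true ∷ τ) disj = begin
    sumMap (weight B true (false ∷ w)) (R^ (true ∷ τ))                 ≡⟨ sumMap-R^-true (weight B true (false ∷ w)) τ ⟩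
    sumMap (weight B true w) (R^ τ) + sumMap (weight B true w) (R^ τ) ≡⟨ cong₂ _+_ IH IH ⟩
    length (R^ τ) + length (R^ τ)                                     ≡⟨ length-R^-true τ ⟨
    length (R^ (true ∷ τ))                                            ∎
    where open ≡-Reasoning
          IH = sumMap-weight-disjoint B w τ disj

  -- a linear form that does not vanish on the support of τ is balanced on R^ τ
  sumMap-weight-balanced : ∀ {n} B b (w τ : BitStr n) → disjoint w τ ≡ false →
    sumMap (weight B b w) (R^ τ) * 2 ≡ (B + 1) * length (R^ τ)
  sumMap-weight-balanced B b [] [] ()
  sumMap-weight-balanced B b (c ∷ w) (false ∷ τ) ¬disj = begin
    sumMap (weight B b (c ∷ w)) (map (false ∷_) (R^ τ)) * 2
      ≡⟨ cong (_* 2) (sumMap-map (weight B b (c ∷ w)) (false ∷_) (R^ τ)) ⟩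
    sumMap (weight B b w) (R^ τ) * 2
      ≡⟨ sumMap-weight-balanced B b w τ (trans (sym (disjoint-false-∷ c w τ)) ¬disj) ⟩
    (B + 1) * length (R^ τ)
      ≡⟨ cong ((B + 1) *_) (List.length-map (false ∷_) (R^ τ)) ⟨
    (B + 1) * length (map (false ∷_) (R^ τ)) ∎
    where open ≡-Reasoning
  sumMap-weight-balanced B b (false ∷ w) (true ∷ τ) ¬disj = begin
    sumMap (weight B b (false ∷ w)) (R^ (true ∷ τ)) * 2 ≡⟨ cong (_* 2) (sumMap-R^-true (weight B b (false ∷ w)) τ) ⟩
    (S + S) * 2                                        ≡⟨ *-distribʳ-+ 2 S S ⟩
    S * 2 + S * 2                                      ≡⟨ cong₂ _+_ IH IH ⟩
    (B + 1) * l + (B + 1) * l                          ≡⟨ *-distribˡ-+ (B + 1) l l ⟨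
    (B + 1) * (l + l)                                  ≡⟨ cong ((B + 1) *_) (length-R^-true τ) ⟨
    (B + 1) * length (R^ (true ∷ τ))                   ∎
    where open ≡-Reasoning
          S = sumMap (weight B b w) (R^ τ)
          l = length (R^ τ)
          IH = sumMap-weight-balanced B b w τ ¬disj
  sumMap-weight-balanced B b (true ∷ w) (true ∷ τ) _ = begin
    sumMap (weight B b (true ∷ w)) (R^ (true ∷ τ)) * 2
      ≡⟨ cong (_* 2) (sumMap-R^-true (weight B b (true ∷ w)) τ) ⟩
    (sumMap (weight B b w) (R^ τ) + sumMap flipped (R^ τ)) * 2
      ≡⟨ cong (_* 2) (sumMap-+ (weight B b w) flipped (R^ τ)) ⟨
    sumMap (λ v → weight B b w v + flipped v) (R^ τ) * 2
      ≡⟨ cong (_* 2) (trans (sumMap-cong (λ v → weights-complementary b (dot v w)) (R^ τ)) (sumMap-const (B + 1) (R^ τ))) ⟩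
    l * (B + 1) * 2
      ≡⟨ rearrange B l ⟩
    (B + 1) * (l + l)
      ≡⟨ cong ((B + 1) *_) (length-R^-true τ) ⟨
    (B + 1) * length (R^ (true ∷ τ)) ∎
    where open ≡-Reasoning
          l = length (R^ τ)
          flipped : BitStr _ → ℕ
          flipped v = B ^ toℕ (agree b (not (dot v w)))
          weights-complementary : ∀ b d → B ^ toℕ (agree b d) + B ^ toℕ (agree b (not d)) ≡ B + 1
          weights-complementary true  true  = cong (_+ 1) (*-identityʳ B)
          weights-complementary true  false = trans (+-comm 1 (B * 1)) (cong (_+ 1) (*-identityʳ B))
          weights-complementary false true  = trans (+-comm 1 (B * 1)) (cong (_+ 1) (*-identityʳ B))
          weights-complementary false false = cong (_+ 1) (*-identityʳ B)
          rearrange : ∀ B l → l * (B + 1) * 2 ≡ (B + 1) * (l + l)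
          rearrange = solve-∀

  sumMap-pow-parityCount : ∀ {n} B b (w τ : BitStr n) L →
    sumMap (λ s → B ^ parityCount b w s) (products (replicate L τ)) ≡ sumMap (weight B b w) (R^ τ) ^ L
  sumMap-pow-parityCount B b w τ zero = refl
  sumMap-pow-parityCount B b w τ (suc L) = begin
    sumMap (λ s → B ^ parityCount b w s) (products (replicate (suc L) τ))
      ≡⟨ sumMap-concatMap-∷ (λ s → B ^ parityCount b w s) (R^ τ) _ ⟩
    sumMap (λ v → sumMap (λ s → B ^ (toℕ (agree b (dot v w)) + parityCount b w s)) Ps) (R^ τ)
      ≡⟨ sumMap-cong (λ v → trans (sumMap-cong (λ s → ^-distribˡ-+-* B (toℕ (agree b (dot v w))) (parityCount b w s)) Ps)
                                   (sumMap-*ˡ (λ s → B ^ parityCount b w s) (weight B b w v) Ps)) (R^ τ) ⟩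
    sumMap (λ v → weight B b w v * sumMap (λ s → B ^ parityCount b w s) Ps) (R^ τ)
      ≡⟨ sumMap-*ʳ (weight B b w) _ (R^ τ) ⟩
    sumMap (weight B b w) (R^ τ) * sumMap (λ s → B ^ parityCount b w s) Ps
      ≡⟨ cong (sumMap (weight B b w) (R^ τ) *_) (sumMap-pow-parityCount B b w τ L) ⟩
    sumMap (weight B b w) (R^ τ) ^ suc L ∎
    where open ≡-Reasoning
          Ps = products (replicate L τ)

  parityCount-tail : ∀ {n} B .{{_ : NonZero B}} a b (w τ : BitStr n) L →
    count (λ s → a ≤ᵇ parityCount b w s) (products (replicate L τ)) * B ^ a ≤ sumMap (weight B b w) (R^ τ) ^ L
  parityCount-tail B a b w τ L =
    ≤-trans (markov B a (parityCount b w) (products (replicate L τ))) (≤-reflexive (sumMap-pow-parityCount B b w τ L))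

  -- the count is in fact always 0: with base 27^t the moment is just the number of samples
  parityCount≥1-bound : ∀ {n} t (w τ : BitStr n) → disjoint w τ ≡ true →
    AtMostFraction 1 (27 ^ t) (λ s → 1 ≤ᵇ parityCount true w s) (products (replicate (4 * t) τ))
  parityCount≥1-bound t w τ disj = atMostFraction (begin
    27 ^ t * c              ≡⟨ *-comm (27 ^ t) c ⟩
    c * 27 ^ t              ≡⟨ cong (c *_) (*-identityʳ (27 ^ t)) ⟨
    c * (27 ^ t) ^ 1        ≤⟨ parityCount-tail (27 ^ t) {{m^n≢0 27 t}} 1 true w τ (4 * t) ⟩
    sumMap (weight (27 ^ t) true w) (R^ τ) ^ (4 * t)          ≡⟨ cong (_^ (4 * t)) (sumMap-weight-disjoint (27 ^ t) w τ disj) ⟩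
    length (R^ τ) ^ (4 * t)                                   ≡⟨ length-products-replicate τ (4 * t) ⟨
    length Ps                                                 ≡⟨ *-identityˡ (length Ps) ⟨
    1 * length Ps                                             ∎)
    where open ≤-Reasoning
          Ps = products (replicate (4 * t) τ)
          c = count (λ s → 1 ≤ᵇ parityCount true w s) Ps

  parityCount≥3t-bound : ∀ {n} t b (w τ : BitStr n) → disjoint w τ ≡ false →
    AtMostFraction (16 ^ t) (27 ^ t) (λ s → 3 * t ≤ᵇ parityCount b w s) (products (replicate (4 * t) τ))
  parityCount≥3t-bound t b w τ ¬disj = atMostFraction (begin
    27 ^ t * c                                ≡⟨ *-comm (27 ^ t) c ⟩
    c * 27 ^ t                                ≡⟨ cong (c *_) (^-*-assoc 3 3 t) ⟩
    c * 3 ^ (3 * t)                           ≤⟨ parityCount-tail 3 (3 * t) b w τ (4 * t) ⟩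
    sumMap (weight 3 b w) (R^ τ) ^ (4 * t)                    ≡⟨ cong (_^ (4 * t)) sumMap-weight-3 ⟩
    (2 * l) ^ (4 * t)                                         ≡⟨ ^-distribʳ-* 2 l (4 * t) ⟩
    2 ^ (4 * t) * l ^ (4 * t)                                 ≡⟨ cong₂ _*_ (^-*-assoc 2 4 t) (length-products-replicate τ (4 * t)) ⟨
    16 ^ t * length Ps                                        ∎)
    where
    open ≤-Reasoning
    Ps = products (replicate (4 * t) τ)
    c = count (λ s → 3 * t ≤ᵇ parityCount b w s) Ps
    l = length (R^ τ)
    sumMap-weight-3 : sumMap (weight 3 b w) (R^ τ) ≡ 2 * l
    sumMap-weight-3 = *-cancelʳ-≡ _ _ 2 (trans (sumMap-weight-balanced 3 b w τ ¬disj) (4*l≡2*l*2 l))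
      where 4*l≡2*l*2 : ∀ l → 4 * l ≡ 2 * l * 2
            4*l≡2*l*2 = solve-∀

  Deviates : ∀ {n L} → ℕ → BitStr n → BitStr n → Vec (BitStr n) L → Bool
  Deviates t w τ s =
    if disjoint w τ then 1 ≤ᵇ parityCount true w s
    else ((3 * t ≤ᵇ parityCount true w s) ∨ (3 * t ≤ᵇ parityCount false w s))

  deviation-bound : ∀ {n} t (w τ : BitStr n) →
    AtMostFraction (2 * 16 ^ t) (27 ^ t) (Deviates t w τ) (products (replicate (4 * t) τ))
  deviation-bound t w τ with disjoint w τ in disj
  ... | true = atMostFraction-weaken 1≤2*16^t (parityCount≥1-bound t w τ disj)
    where 1≤2*16^t = ≤-trans (m^n>0 16 t) (m≤n*m (16 ^ t) 2)
  ... | false = atMostFraction-weaken (≤-reflexive (cong (16 ^ t +_) (sym (+-identityʳ (16 ^ t)))))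
    (atMostFraction-∨ (parityCount≥3t-bound t true w τ disj) (parityCount≥3t-bound t false w τ disj))

  parityCount-true+false : ∀ {n L} (w : BitStr n) (s : Vec (BitStr n) L) → parityCount true w s + parityCount false w s ≡ L
  parityCount-true+false w [] = refl
  parityCount-true+false w (v ∷ s) with dot v w
  ... | true = cong suc (parityCount-true+false w s)
  ... | false = trans (+-suc (parityCount true w s) _) (cong suc (parityCount-true+false w s))

  ¬Deviates⇒parityCount≡0 : ∀ {n L} t (w τ : BitStr n) (s : Vec (BitStr n) L) →
    disjoint w τ ≡ true → ¬ T (Deviates t w τ s) → parityCount true w s ≡ 0
  ¬Deviates⇒parityCount≡0 t w τ s disj ¬dev rewrite disj with parityCount true w s
  ... | zero = refl
  ... | suc c = ⊥-elim (¬dev _)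

  ¬Deviates⇒balanced : ∀ {n} t (w τ : BitStr n) (s : Vec (BitStr n) (4 * t)) →
    disjoint w τ ≡ false → ¬ T (Deviates t w τ s) → t ≤ parityCount true w s × parityCount true w s ≤ 3 * t
  ¬Deviates⇒balanced t w τ s ¬disj ¬dev rewrite ¬disj = t≤c , <⇒≤ c<3t
    where
    c = parityCount true w s
    c' = parityCount false w s
    below-3t : ∀ {d} → (T (3 * t ≤ᵇ d) → T ((3 * t ≤ᵇ c) ∨ (3 * t ≤ᵇ c'))) → d < 3 * t
    below-3t into = ≰⇒> (λ 3t≤d → ¬dev (into (≤⇒≤ᵇ 3t≤d)))
    c<3t : c < 3 * t
    c<3t = below-3t (λ h → Equivalence.from T-∨ (inj₁ h))
    c'<3t : c' < 3 * t
    c'<3t = below-3t (λ h → Equivalence.from T-∨ (inj₂ h))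
    t≤c : t ≤ c
    t≤c = +-cancelʳ-≤ (3 * t) t c (begin
      t + 3 * t ≡⟨ parityCount-true+false w s ⟨
      c + c'    ≤⟨ +-monoʳ-≤ c (<⇒≤ c'<3t) ⟩
      c + 3 * t ∎)
      where open ≤-Reasoning

module Arithmetic where
  open import Data.Nat as ℕ using (ℕ; zero; suc; z≤n; s≤s)
  import Data.Nat.Properties as ℕ
  import Data.Integer as ℤ
  open import Data.Fin using (Fin; zero; suc)
  open import Data.Rational
  open import Data.Rational.Properties
  import Data.Rational.Unnormalised as ℚᵘ
  import Data.Rational.Unnormalised.Properties as ℚᵘ
  open import Data.Rational.Solver using (module +-*-Solver)
  open import Data.Nat.Coprimality using (1-coprimeTo) renaming (sym to coprime-sym)
  open import Relation.Binary.PropositionalEquality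

  infixr 8 _^_
  _^_ : ℚ → ℕ → ℚ
  x ^ zero = 1ℚ
  x ^ suc k = x * x ^ k

  ∑ : ∀ {N} → (Fin N → ℚ) → ℚ
  ∑ {zero} f = 0ℚ
  ∑ {suc N} f = f zero + ∑ (λ k → f (suc k))

  ∑-cong : ∀ {N} {f g : Fin N → ℚ} → (∀ k → f k ≡ g k) → ∑ f ≡ ∑ g
  ∑-cong {zero} f≡g = refl
  ∑-cong {suc N} f≡g = cong₂ _+_ (f≡g zero) (∑-cong (λ k → f≡g (suc k)))

  ∑-*ˡ : ∀ {N} c (f : Fin N → ℚ) → ∑ (λ k → c * f k) ≡ c * ∑ f
  ∑-*ˡ {zero} c f = sym (*-zeroʳ c)
  ∑-*ˡ {suc N} c f = trans (cong (c * f zero +_) (∑-*ˡ c (λ k → f (suc k)))) (sym (*-distribˡ-+ c (f zero) _))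

  *-distribʳ-- : ∀ a b c → a * c - b * c ≡ (a - b) * c
  *-distribʳ-- = solve 3 (λ a b c → a :* c :- b :* c := (a :- b) :* c) refl
    where open +-*-Solver

  ∑-- : ∀ {N} (f g : Fin N → ℚ) → ∑ f - ∑ g ≡ ∑ (λ k → f k - g k)
  ∑-- {zero} f g = refl
  ∑-- {suc N} f g = trans (interchange-- (f zero) (g zero) (∑ (λ k → f (suc k))) (∑ (λ k → g (suc k))))
    (cong (f zero - g zero +_) (∑-- (λ k → f (suc k)) (λ k → g (suc k))))
    where open +-*-Solver
          interchange-- : ∀ a b x y → (a + x) - (b + y) ≡ (a - b) + (x - y)
          interchange-- = solve 4 (λ a b x y → (a :+ x) :- (b :+ y) := (a :- b) :+ (x :- y)) refl

  toℚ : ℕ → ℚ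
  toℚ zero = 0ℚ
  toℚ (suc n) = 1ℚ + toℚ n

  toℚ-homo-+ : ∀ a b → toℚ (a ℕ.+ b) ≡ toℚ a + toℚ b
  toℚ-homo-+ zero b = sym (+-identityˡ (toℚ b))
  toℚ-homo-+ (suc a) b = trans (cong (1ℚ +_) (toℚ-homo-+ a b)) (sym (+-assoc 1ℚ (toℚ a) (toℚ b)))

  toℚ-homo-* : ∀ a b → toℚ (a ℕ.* b) ≡ toℚ a * toℚ b
  toℚ-homo-* zero b = sym (*-zeroˡ (toℚ b))
  toℚ-homo-* (suc a) b = begin
    toℚ (b ℕ.+ a ℕ.* b)       ≡⟨ toℚ-homo-+ b (a ℕ.* b) ⟩
    toℚ b + toℚ (a ℕ.* b)     ≡⟨ cong₂ _+_ (sym (*-identityˡ (toℚ b))) (toℚ-homo-* a b) ⟩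
    1ℚ * toℚ b + toℚ a * toℚ b ≡⟨ *-distribʳ-+ (toℚ b) 1ℚ (toℚ a) ⟨
    (1ℚ + toℚ a) * toℚ b       ∎
    where open ≡-Reasoning

  toℚ-nonNeg : ∀ a → 0ℚ ≤ toℚ a
  toℚ-nonNeg zero = ≤-refl
  toℚ-nonNeg (suc a) = +-mono-≤ (nonNegative⁻¹ 1ℚ) (toℚ-nonNeg a)

  toℚ-mono-≤ : ∀ {a b} → a ℕ.≤ b → toℚ a ≤ toℚ b
  toℚ-mono-≤ {zero} {b} z≤n = toℚ-nonNeg b
  toℚ-mono-≤ (s≤s a≤b) = +-monoʳ-≤ 1ℚ (toℚ-mono-≤ a≤b)

  _/1 : ℕ → ℚ
  k /1 = mkℚ (ℤ.+ k) 0 (coprime-sym (1-coprimeTo k))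

  toℚ≡/1 : ∀ k → toℚ k ≡ k /1
  toℚ≡/1 zero = refl
  toℚ≡/1 (suc k) = toℚᵘ-injective (ℚᵘ.≃-trans (toℚᵘ-homo-+ 1ℚ (toℚ k)) 1+k≃suc-k)
    where
    1+k≃suc-k : toℚᵘ 1ℚ ℚᵘ.+ toℚᵘ (toℚ k) ℚᵘ.≃ toℚᵘ (suc k /1)
    1+k≃suc-k rewrite toℚ≡/1 k = ℚᵘ.*≡* (cross-multiplied (ℤ.+ k))
      where cross-multiplied : ∀ z → (ℤ.1ℤ ℤ.* ℤ.1ℤ ℤ.+ z ℤ.* ℤ.1ℤ) ℤ.* ℤ.1ℤ ≡ (ℤ.1ℤ ℤ.+ z) ℤ.* (ℤ.1ℤ ℤ.* ℤ.1ℤ)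
            cross-multiplied = solve-∀
              where open import Data.Integer.Tactic.RingSolver using (solve-∀)

  reciprocal : (k : ℕ) .{{_ : ℕ.NonZero k}} → ℚ
  reciprocal k = 1/ (k /1)

  toℚ-*-reciprocal : ∀ k .{{_ : ℕ.NonZero k}} → toℚ k * reciprocal k ≡ 1ℚ
  toℚ-*-reciprocal k rewrite toℚ≡/1 k = *-inverseʳ (k /1)

  1^p≡1 : ∀ p → 1ℚ ^ p ≡ 1ℚ
  1^p≡1 zero = refl
  1^p≡1 (suc p) = trans (*-identityˡ _) (1^p≡1 p)

  reciprocal-nonNeg : ∀ k .{{_ : ℕ.NonZero k}} → 0ℚ ≤ reciprocal k
  reciprocal-nonNeg (suc k) = nonNegative⁻¹ _

  toℚ-*-reciprocal-2* : ∀ t .{{_ : ℕ.NonZero t}} → toℚ t * reciprocal (2 ℕ.* t) {{ℕ.m*n≢0 2 t}} ≡ ½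
  toℚ-*-reciprocal-2* t = begin
    toℚ t * r                  ≡⟨ *-identityˡ (toℚ t * r) ⟨
    ½ * toℚ 2 * (toℚ t * r)    ≡⟨ *-assoc ½ (toℚ 2) (toℚ t * r) ⟩
    ½ * (toℚ 2 * (toℚ t * r))  ≡⟨ cong (½ *_) (*-assoc (toℚ 2) (toℚ t) r) ⟨
    ½ * (toℚ 2 * toℚ t * r)    ≡⟨ cong (λ z → ½ * (z * r)) (toℚ-homo-* 2 t) ⟨
    ½ * (toℚ (2 ℕ.* t) * r)    ≡⟨ cong (½ *_) (toℚ-*-reciprocal (2 ℕ.* t) {{ℕ.m*n≢0 2 t}}) ⟩
    ½ * 1ℚ                     ≡⟨ *-identityʳ ½ ⟩
    ½                          ∎
    where open ≡-Reasoning
          r = reciprocal (2 ℕ.* t) {{ℕ.m*n≢0 2 t}}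

module Polynomials where
  open import Data.Bool using (Bool; true; false; _xor_)
  open import Data.Nat as ℕ using (ℕ; zero; suc; _≤_; z≤n; s≤s)
  import Data.Nat.Properties as ℕ
  open import Data.Fin using (Fin; zero; suc)
  open import Data.Fin.Subset using (Subset; ⊥; ⁅_⁆; _∪_; ∣_∣)
  open import Data.Fin.Subset.Properties using (∣⊥∣≡0; ∣⁅x⁆∣≡1)
  open import Data.Rational using (ℚ; 1ℚ; _+_; _*_; -_)
  open import Data.Rational.Properties
  open import Data.List using (List; []; _∷_; [_]; map; _++_; concat; tabulate)
  open import Data.List.Relation.Unary.All using (All; []; _∷_)
  import Data.List.Relation.Unary.All.Properties as All
  open import Data.Vec using ([]; _∷_; lookup)
  open import Data.Product using (_×_; _,_)
  open import Algebra.Bundles using (CommutativeMonoid)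
  open import Algebra.Properties.CommutativeSemigroup
    (CommutativeMonoid.commutativeSemigroup *-1-commutativeMonoid) using (interchange; x∙yz≈y∙xz)
  open import Relation.Binary.PropositionalEquality hiding ([_])
  open import Defs using (BitStr; Poly; bitℚ; monomial; eval; DegreeAtMost)
  open Arithmetic using (_^_; ∑)

  bitℚ-idem : ∀ b → bitℚ b ≡ bitℚ b * bitℚ b
  bitℚ-idem true = refl
  bitℚ-idem false = refl

  bitℚ-xor-true : ∀ c → 1ℚ + - 1ℚ * bitℚ c ≡ bitℚ (c xor true)
  bitℚ-xor-true true = refl
  bitℚ-xor-true false = refl

  monomial-⊥ : ∀ {m} (y : BitStr m) → monomial ⊥ y ≡ 1ℚ
  monomial-⊥ [] = refl
  monomial-⊥ (b ∷ y) = trans (*-identityˡ _) (monomial-⊥ y)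

  monomial-⁅⁆ : ∀ {m} (j : Fin m) (y : BitStr m) → monomial ⁅ j ⁆ y ≡ bitℚ (lookup y j)
  monomial-⁅⁆ zero (b ∷ y) = trans (cong (bitℚ b *_) (monomial-⊥ y)) (*-identityʳ _)
  monomial-⁅⁆ (suc j) (b ∷ y) = trans (*-identityˡ _) (monomial-⁅⁆ j y)

  monomial-∪ : ∀ {m} (S T : Subset m) (y : BitStr m) → monomial (S ∪ T) y ≡ monomial S y * monomial T y
  monomial-∪ [] [] [] = refl
  monomial-∪ (true ∷ S) (true ∷ T) (b ∷ y) = begin
    bitℚ b * monomial (S ∪ T) y                    ≡⟨ cong₂ _*_ (bitℚ-idem b) (monomial-∪ S T y) ⟩
    bitℚ b * bitℚ b * (monomial S y * monomial T y) ≡⟨ interchange (bitℚ b) (bitℚ b) (monomial S y) (monomial T y) ⟩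
    bitℚ b * monomial S y * (bitℚ b * monomial T y) ∎
    where open ≡-Reasoning
  monomial-∪ (true ∷ S) (false ∷ T) (b ∷ y) = begin
    bitℚ b * monomial (S ∪ T) y                   ≡⟨ cong (bitℚ b *_) (monomial-∪ S T y) ⟩
    bitℚ b * (monomial S y * monomial T y)        ≡⟨ *-assoc (bitℚ b) (monomial S y) (monomial T y) ⟨
    bitℚ b * monomial S y * monomial T y          ≡⟨ cong (bitℚ b * monomial S y *_) (*-identityˡ (monomial T y)) ⟨
    bitℚ b * monomial S y * (1ℚ * monomial T y)   ∎
    where open ≡-Reasoning
  monomial-∪ (false ∷ S) (true ∷ T) (b ∷ y) = begin
    bitℚ b * monomial (S ∪ T) y                   ≡⟨ cong (bitℚ b *_) (monomial-∪ S T y) ⟩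
    bitℚ b * (monomial S y * monomial T y)        ≡⟨ x∙yz≈y∙xz (bitℚ b) (monomial S y) (monomial T y) ⟩
    monomial S y * (bitℚ b * monomial T y)        ≡⟨ cong (_* (bitℚ b * monomial T y)) (*-identityˡ (monomial S y)) ⟨
    1ℚ * monomial S y * (bitℚ b * monomial T y)   ∎
    where open ≡-Reasoning
  monomial-∪ (false ∷ S) (false ∷ T) (b ∷ y) = begin
    1ℚ * monomial (S ∪ T) y                       ≡⟨ *-identityˡ (monomial (S ∪ T) y) ⟩
    monomial (S ∪ T) y                            ≡⟨ monomial-∪ S T y ⟩
    monomial S y * monomial T y                   ≡⟨ cong₂ _*_ (*-identityˡ (monomial S y)) (*-identityˡ (monomial T y)) ⟨
    1ℚ * monomial S y * (1ℚ * monomial T y)       ∎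
    where open ≡-Reasoning

  ∣p∪q∣≤∣p∣+∣q∣ : ∀ {m} (S T : Subset m) → ∣ S ∪ T ∣ ≤ ∣ S ∣ ℕ.+ ∣ T ∣
  ∣p∪q∣≤∣p∣+∣q∣ [] [] = z≤n
  ∣p∪q∣≤∣p∣+∣q∣ (true ∷ S) (true ∷ T) = s≤s (ℕ.≤-trans (∣p∪q∣≤∣p∣+∣q∣ S T) (ℕ.+-monoʳ-≤ ∣ S ∣ (ℕ.n≤1+n _)))
  ∣p∪q∣≤∣p∣+∣q∣ (true ∷ S) (false ∷ T) = s≤s (∣p∪q∣≤∣p∣+∣q∣ S T)
  ∣p∪q∣≤∣p∣+∣q∣ (false ∷ S) (true ∷ T) = ℕ.≤-trans (s≤s (∣p∪q∣≤∣p∣+∣q∣ S T)) (ℕ.≤-reflexive (sym (ℕ.+-suc ∣ S ∣ ∣ T ∣)))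
  ∣p∪q∣≤∣p∣+∣q∣ (false ∷ S) (false ∷ T) = ∣p∪q∣≤∣p∣+∣q∣ S T

  module _ {m : ℕ} where
    constant : ℚ → Poly m
    constant c = [ (c , ⊥) ]

    var : Fin m → Poly m
    var j = [ (1ℚ , ⁅ j ⁆) ]

    scale : ℚ → Poly m → Poly m
    scale c = map (λ { (d , S) → (c * d , S) })

    literal : Fin m → Bool → Poly m
    literal j true = constant 1ℚ ++ scale (- 1ℚ) (var j)
    literal j false = var j

    mulMonomial : ℚ × Subset m → Poly m → Poly m
    mulMonomial (c , S) = map (λ { (d , T) → (c * d , S ∪ T) })

    mul : Poly m → Poly m → Poly m
    mul [] q = []
    mul (t ∷ p) q = mulMonomial t q ++ mul p q

    pow : Poly m → ℕ → Poly m
    pow p zero = constant 1ℚ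
    pow p (suc k) = mul p (pow p k)

    module _ (y : BitStr m) where
      eval-++ : (p q : Poly m) → eval (p ++ q) y ≡ eval p y + eval q y
      eval-++ [] q = sym (+-identityˡ _)
      eval-++ ((c , S) ∷ p) q = trans (cong (c * monomial S y +_) (eval-++ p q)) (sym (+-assoc (c * monomial S y) (eval p y) (eval q y)))

      eval-constant : (c : ℚ) → eval (constant c) y ≡ c
      eval-constant c = trans (+-identityʳ _) (trans (cong (c *_) (monomial-⊥ y)) (*-identityʳ c))

      eval-var : (j : Fin m) → eval (var j) y ≡ bitℚ (lookup y j)
      eval-var j = trans (+-identityʳ _) (trans (*-identityˡ _) (monomial-⁅⁆ j y))

      eval-scale : (c : ℚ) (p : Poly m) → eval (scale c p) y ≡ c * eval p y
      eval-scale c [] = sym (*-zeroʳ c)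
      eval-scale c ((d , S) ∷ p) =
        trans (cong₂ _+_ (*-assoc c d _) (eval-scale c p)) (sym (*-distribˡ-+ c _ (eval p y)))

      eval-literal : (j : Fin m) (b : Bool) → eval (literal j b) y ≡ bitℚ (lookup y j xor b)
      eval-literal j true = begin
        eval (constant 1ℚ ++ scale (- 1ℚ) (var j)) y         ≡⟨ eval-++ (constant 1ℚ) (scale (- 1ℚ) (var j)) ⟩
        eval (constant 1ℚ) y + eval (scale (- 1ℚ) (var j)) y ≡⟨ cong₂ _+_ (eval-constant 1ℚ) (eval-scale (- 1ℚ) (var j)) ⟩
        1ℚ + - 1ℚ * eval (var j) y                           ≡⟨ cong (λ z → 1ℚ + - 1ℚ * z) (eval-var j) ⟩
        1ℚ + - 1ℚ * bitℚ (lookup y j)                        ≡⟨ bitℚ-xor-true (lookup y j) ⟩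
        bitℚ (lookup y j xor true)                           ∎
        where open ≡-Reasoning
      eval-literal j false = trans (eval-var j) (cong bitℚ (lemma (lookup y j)))
        where lemma : ∀ c → c ≡ c xor false
              lemma true = refl
              lemma false = refl

      eval-mulMonomial : (c : ℚ) (S : Subset m) (q : Poly m) →
        eval (mulMonomial (c , S) q) y ≡ c * monomial S y * eval q y
      eval-mulMonomial c S [] = sym (*-zeroʳ (c * monomial S y))
      eval-mulMonomial c S ((d , T) ∷ q) = begin
        c * d * monomial (S ∪ T) y + eval (mulMonomial (c , S) q) y
          ≡⟨ cong₂ _+_ (cong (c * d *_) (monomial-∪ S T y)) (eval-mulMonomial c S q) ⟩
        c * d * (monomial S y * monomial T y) + c * monomial S y * eval q y
          ≡⟨ cong (_+ c * monomial S y * eval q y) (interchange c d (monomial S y) (monomial T y)) ⟩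
        c * monomial S y * (d * monomial T y) + c * monomial S y * eval q y
          ≡⟨ *-distribˡ-+ (c * monomial S y) _ (eval q y) ⟨
        c * monomial S y * (d * monomial T y + eval q y) ∎
        where open ≡-Reasoning

      eval-mul : (p q : Poly m) → eval (mul p q) y ≡ eval p y * eval q y
      eval-mul [] q = sym (*-zeroˡ (eval q y))
      eval-mul ((c , S) ∷ p) q = begin
        eval (mulMonomial (c , S) q ++ mul p q) y                    ≡⟨ eval-++ (mulMonomial (c , S) q) (mul p q) ⟩
        eval (mulMonomial (c , S) q) y + eval (mul p q) y            ≡⟨ cong₂ _+_ (eval-mulMonomial c S q) (eval-mul p q) ⟩
        c * monomial S y * eval q y + eval p y * eval q y            ≡⟨ *-distribʳ-+ (eval q y) (c * monomial S y) (eval p y) ⟨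
        (c * monomial S y + eval p y) * eval q y                     ∎
        where open ≡-Reasoning

      eval-pow : (p : Poly m) (k : ℕ) → eval (pow p k) y ≡ eval p y ^ k
      eval-pow p zero = eval-constant 1ℚ
      eval-pow p (suc k) = trans (eval-mul p (pow p k)) (cong (eval p y *_) (eval-pow p k))

      eval-concat-tabulate : ∀ {N} (ps : Fin N → Poly m) → eval (concat (tabulate ps)) y ≡ ∑ (λ k → eval (ps k) y)
      eval-concat-tabulate {zero} ps = refl
      eval-concat-tabulate {suc N} ps =
        trans (eval-++ (ps zero) _) (cong (eval (ps zero) y +_) (eval-concat-tabulate (λ k → ps (suc k))))

    degree-++ : ∀ {d} {p q : Poly m} → DegreeAtMost d p → DegreeAtMost d q → DegreeAtMost d (p ++ q)
    degree-++ = All.++⁺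

    degree-weaken : ∀ {d e} {p : Poly m} → d ≤ e → DegreeAtMost d p → DegreeAtMost e p
    degree-weaken d≤e [] = []
    degree-weaken d≤e (h ∷ hs) = ℕ.≤-trans h d≤e ∷ degree-weaken d≤e hs

    degree-constant : ∀ {d} c → DegreeAtMost d (constant c)
    degree-constant {d} c = ℕ.≤-trans (ℕ.≤-reflexive (∣⊥∣≡0 m)) z≤n ∷ []

    degree-var : ∀ j → DegreeAtMost 1 (var j)
    degree-var j = ℕ.≤-reflexive (∣⁅x⁆∣≡1 j) ∷ []

    degree-scale : ∀ {d} c {p : Poly m} → DegreeAtMost d p → DegreeAtMost d (scale c p)
    degree-scale c [] = []
    degree-scale c (h ∷ hs) = h ∷ degree-scale c hs

    degree-literal : ∀ j b → DegreeAtMost 1 (literal j b)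
    degree-literal j true = degree-++ (degree-constant 1ℚ) (degree-scale (- 1ℚ) (degree-var j))
    degree-literal j false = degree-var j

    degree-mulMonomial : ∀ {d e} c S {q : Poly m} → ∣ S ∣ ≤ d → DegreeAtMost e q →
      DegreeAtMost (d ℕ.+ e) (mulMonomial (c , S) q)
    degree-mulMonomial c S hS [] = []
    degree-mulMonomial c S {(_ , T) ∷ _} hS (h ∷ hs) =
      ℕ.≤-trans (∣p∪q∣≤∣p∣+∣q∣ S T) (ℕ.+-mono-≤ hS h) ∷ degree-mulMonomial c S hS hs

    degree-mul : ∀ {d e} {p q : Poly m} → DegreeAtMost d p → DegreeAtMost e q → DegreeAtMost (d ℕ.+ e) (mul p q)
    degree-mul {p = []} [] hq = []
    degree-mul {p = (c , S) ∷ p} (h ∷ hp) hq = degree-++ (degree-mulMonomial c S h hq) (degree-mul hp hq)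

    degree-pow : ∀ {p : Poly m} k → DegreeAtMost 1 p → DegreeAtMost k (pow p k)
    degree-pow zero h = degree-constant 1ℚ
    degree-pow (suc k) h = degree-mul h (degree-pow k h)

    degree-concat : ∀ {d} {ps : List (Poly m)} → All (DegreeAtMost d) ps → DegreeAtMost d (concat ps)
    degree-concat [] = []
    degree-concat (h ∷ hs) = degree-++ h (degree-concat hs)

module Estimates where
  open import Data.Bool using (true; false)
  open import Data.Nat as ℕ using (ℕ; zero; suc)
  open import Data.Fin using (Fin; zero; suc)
  open import Data.Rational
  open import Data.Rational.Properties
  open import Data.Rational.Solver using (module +-*-Solver)
  open import Data.Sum using (inj₁; inj₂)
  open import Relation.Binary.PropositionalEquality
  open import Defs using (oneSixth; bitℚ)
  open Arithmetic

  ∣x∣≤a : ∀ {a x} → - a ≤ x → x ≤ a → ∣ x ∣ ≤ a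
  ∣x∣≤a {a} {x} -a≤x x≤a with ∣p∣≡p∨∣p∣≡-p x
  ... | inj₁ ∣x∣≡x = subst (_≤ a) (sym ∣x∣≡x) x≤a
  ... | inj₂ ∣x∣≡-x = subst (_≤ a) (sym ∣x∣≡-x) (subst (- x ≤_) (⁻¹-involutive a) (neg-antimono-≤ -a≤x))
    where open import Algebra.Properties.Group +-0-group using (⁻¹-involutive)

  ½^-nonNeg : ∀ p → NonNegative (½ ^ p)
  ½^-nonNeg zero = _
  ½^-nonNeg (suc p) = nonNeg*nonNeg⇒nonNeg ½ (½ ^ p) {{½^-nonNeg p}}

  ∣x^p∣≤½^p : ∀ {x} p → ∣ x ∣ ≤ ½ → ∣ x ^ p ∣ ≤ ½ ^ p
  ∣x^p∣≤½^p zero _ = ≤-refl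
  ∣x^p∣≤½^p {x} (suc p) ∣x∣≤½ = begin
    ∣ x * x ^ p ∣     ≡⟨ ∣p*q∣≡∣p∣*∣q∣ x (x ^ p) ⟩
    ∣ x ∣ * ∣ x ^ p ∣ ≤⟨ *-monoʳ-≤-nonNeg ∣ x ^ p ∣ {{∣-∣-nonNeg (x ^ p)}} ∣x∣≤½ ⟩
    ½ * ∣ x ^ p ∣     ≤⟨ *-monoˡ-≤-nonNeg ½ (∣x^p∣≤½^p p ∣x∣≤½) ⟩
    ½ * ½ ^ p         ∎
    where open ≤-Reasoning

  toℚ-2^p*½^p : ∀ p → toℚ (2 ℕ.^ p) * ½ ^ p ≡ 1ℚ
  toℚ-2^p*½^p zero = refl
  toℚ-2^p*½^p (suc p) = begin
    toℚ (2 ℕ.* 2 ℕ.^ p) * (½ * ½ ^ p)      ≡⟨ cong (_* (½ * ½ ^ p)) (toℚ-homo-* 2 (2 ℕ.^ p)) ⟩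
    toℚ 2 * toℚ (2 ℕ.^ p) * (½ * ½ ^ p)    ≡⟨ interchange (toℚ 2) (toℚ (2 ℕ.^ p)) ½ (½ ^ p) ⟩
    toℚ 2 * ½ * (toℚ (2 ℕ.^ p) * ½ ^ p)    ≡⟨ cong (toℚ 2 * ½ *_) (toℚ-2^p*½^p p) ⟩
    1ℚ                                      ∎
    where open ≡-Reasoning
          open import Algebra.Bundles using (CommutativeMonoid)
          open import Algebra.Properties.CommutativeSemigroup
            (CommutativeMonoid.commutativeSemigroup *-1-commutativeMonoid) using (interchange)

  ∣1-u*c∣≤½ : ∀ {u} t c → 0ℚ ≤ u → toℚ t * u ≡ ½ → t ℕ.≤ c → c ℕ.≤ 3 ℕ.* t → ∣ 1ℚ + - u * toℚ c ∣ ≤ ½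
  ∣1-u*c∣≤½ {u} t c 0≤u t*u≡½ t≤c c≤3t = ∣x∣≤a lower upper
    where
    open +-*-Solver
    rearrange : ∀ x y → 1ℚ + - y * x ≡ 1ℚ - x * y
    rearrange = solve 2 (λ x y → con 1ℚ :+ (:- y) :* x := con 1ℚ :- x :* y) refl
    ½≤c*u : ½ ≤ toℚ c * u
    ½≤c*u = subst (_≤ toℚ c * u) t*u≡½ (*-monoʳ-≤-nonNeg u {{nonNegative 0≤u}} (toℚ-mono-≤ t≤c))
    c*u≤3/2 : toℚ c * u ≤ toℚ 3 * ½
    c*u≤3/2 = ≤-trans (*-monoʳ-≤-nonNeg u {{nonNegative 0≤u}} (toℚ-mono-≤ c≤3t))
      (≤-reflexive (trans (cong (_* u) (toℚ-homo-* 3 t)) (trans (*-assoc (toℚ 3) (toℚ t) u) (cong (toℚ 3 *_) t*u≡½))))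
    upper : 1ℚ + - u * toℚ c ≤ ½
    upper = subst (_≤ ½) (sym (rearrange (toℚ c) u)) (+-monoʳ-≤ 1ℚ (neg-antimono-≤ ½≤c*u))
    lower : - ½ ≤ 1ℚ + - u * toℚ c
    lower = subst (- ½ ≤_) (sym (rearrange (toℚ c) u)) (+-monoʳ-≤ 1ℚ (neg-antimono-≤ c*u≤3/2))

  ∣x*bitℚ∣≤∣x∣ : ∀ x b → ∣ x * bitℚ b ∣ ≤ ∣ x ∣
  ∣x*bitℚ∣≤∣x∣ x true = ≤-reflexive (cong ∣_∣ (*-identityʳ x))
  ∣x*bitℚ∣≤∣x∣ x false = subst (_≤ ∣ x ∣) (cong ∣_∣ (sym (*-zeroʳ x))) (nonNegative⁻¹ ∣ x ∣ {{∣-∣-nonNeg x}})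

  ∣∑∣≤ : ∀ {N} (f : Fin N → ℚ) β → (∀ k → ∣ f k ∣ ≤ β) → ∣ ∑ f ∣ ≤ toℚ N * β
  ∣∑∣≤ {zero} f β _ = ≤-reflexive (sym (*-zeroˡ β))
  ∣∑∣≤ {suc N} f β ∣f∣≤β = begin
    ∣ f zero + ∑ (λ k → f (suc k)) ∣         ≤⟨ ∣p+q∣≤∣p∣+∣q∣ (f zero) _ ⟩
    ∣ f zero ∣ + ∣ ∑ (λ k → f (suc k)) ∣     ≤⟨ +-mono-≤ (∣f∣≤β zero) (∣∑∣≤ (λ k → f (suc k)) β (λ k → ∣f∣≤β (suc k))) ⟩
    β + toℚ N * β                            ≡⟨ cong (_+ toℚ N * β) (*-identityˡ β) ⟨
    1ℚ * β + toℚ N * β                       ≡⟨ *-distribʳ-+ β 1ℚ (toℚ N) ⟨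
    (1ℚ + toℚ N) * β                         ∎
    where open ≤-Reasoning

  toℚ*½^p≤⅙ : ∀ n p → 6 ℕ.* n ℕ.≤ 2 ℕ.^ p → toℚ n * ½ ^ p ≤ oneSixth
  toℚ*½^p≤⅙ n p 6n≤2^p = begin
    toℚ n * ½ ^ p                            ≡⟨ *-identityˡ (toℚ n * ½ ^ p) ⟨
    1ℚ * (toℚ n * ½ ^ p)                     ≡⟨ cong (_* (toℚ n * ½ ^ p)) ⅙*6≡1 ⟨
    oneSixth * toℚ 6 * (toℚ n * ½ ^ p)       ≡⟨ *-assoc oneSixth (toℚ 6) (toℚ n * ½ ^ p) ⟩
    oneSixth * (toℚ 6 * (toℚ n * ½ ^ p))     ≡⟨ cong (oneSixth *_) (*-assoc (toℚ 6) (toℚ n) (½ ^ p)) ⟨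
    oneSixth * (toℚ 6 * toℚ n * ½ ^ p)       ≡⟨ cong (λ z → oneSixth * (z * ½ ^ p)) (toℚ-homo-* 6 n) ⟨
    oneSixth * (toℚ (6 ℕ.* n) * ½ ^ p)       ≤⟨ *-monoˡ-≤-nonNeg oneSixth (*-monoʳ-≤-nonNeg (½ ^ p) {{½^-nonNeg p}} (toℚ-mono-≤ 6n≤2^p)) ⟩
    oneSixth * (toℚ (2 ℕ.^ p) * ½ ^ p)       ≡⟨ cong (oneSixth *_) (toℚ-2^p*½^p p) ⟩
    oneSixth * 1ℚ                            ≡⟨ *-identityʳ oneSixth ⟩
    oneSixth                                 ∎
    where open ≤-Reasoning
          ⅙*6≡1 : oneSixth * toℚ 6 ≡ 1ℚ
          ⅙*6≡1 = refl

module BitStrings where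
  open import Data.Bool using (Bool; true; false; not; _∧_; _xor_; if_then_else_)
  open import Data.Bool.Properties using (∧-distribˡ-xor; xor-identityʳ; xor-∧-commutativeRing)
  open import Data.Nat as ℕ using (ℕ; zero; suc; _≤ᵇ_; _≤?_)
  import Data.Nat.Properties as ℕ
  open import Data.Fin using (Fin; zero; suc)
  open import Data.Vec using ([]; _∷_; lookup; zipWith; tabulate)
  open import Data.Rational using (ℚ; 0ℚ; 1ℚ; _+_; _*_)
  open import Data.Rational.Properties using (*-identityˡ; *-zeroˡ; +-identityˡ; +-identityʳ; *-assoc)
  open import Relation.Nullary.Decidable using (dec-true; dec-false)
  open import Relation.Binary.PropositionalEquality
  open import Algebra.Bundles using (CommutativeRing)
  open import Algebra.Properties.CommutativeSemigroup
    (CommutativeRing.+-commutativeSemigroup xor-∧-commutativeRing) using (interchange)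
  open import Data.List using (map; length)
  import Data.List.Properties as List
  open import Data.List.Membership.Propositional using (_∈_)
  open import Data.List.Membership.Propositional.Properties using (∈-++⁺ˡ; ∈-++⁺ʳ; ∈-map⁺)
  open import Data.List.Relation.Unary.Any using (here)
  open import Defs using (BitStr; allBits; dot; unitVec; val; GT; bitℚ)
  open Deviation using (disjoint)
  open Arithmetic using (∑; ∑-cong; ∑-*ˡ)

  infixl 6 _⊕_
  _⊕_ : ∀ {n} → BitStr n → BitStr n → BitStr n
  _⊕_ = zipWith _xor_

  dot-⊕ : ∀ {n} (v x i : BitStr n) → dot v (x ⊕ i) ≡ dot v x xor dot v i
  dot-⊕ [] [] [] = refl
  dot-⊕ (a ∷ v) (c ∷ x) (d ∷ i) = begin
    (a ∧ (c xor d)) xor dot v (x ⊕ i)                ≡⟨ cong₂ _xor_ (∧-distribˡ-xor a c d) (dot-⊕ v x i) ⟩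
    ((a ∧ c) xor (a ∧ d)) xor (dot v x xor dot v i)  ≡⟨ interchange (a ∧ c) (a ∧ d) (dot v x) (dot v i) ⟩
    ((a ∧ c) xor dot v x) xor ((a ∧ d) xor dot v i)  ∎
    where open ≡-Reasoning

  dot-unitVec : ∀ {n} (j : Fin n) (x : BitStr n) → dot (unitVec j) x ≡ lookup x j
  dot-unitVec zero (c ∷ x) = trans (cong (c xor_) (dot-zeros x)) (xor-identityʳ c)
    where dot-zeros : ∀ {n} (x : BitStr n) → dot (tabulate (λ _ → false)) x ≡ false
          dot-zeros [] = refl
          dot-zeros (c ∷ x) = dot-zeros x
  dot-unitVec (suc j) (c ∷ x) = dot-unitVec j x

  -- x and i agree on their first k bits iff x ⊕ i is disjoint from prefix k
  prefix : ∀ {n} → Fin (suc n) → BitStr n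
  prefix {zero} zero = []
  prefix {suc n} zero = false ∷ prefix zero
  prefix {suc n} (suc k) = true ∷ prefix k

  disjoint-prefix-zero : ∀ {n} (w : BitStr n) → disjoint w (prefix zero) ≡ true
  disjoint-prefix-zero [] = refl
  disjoint-prefix-zero (true ∷ w) = disjoint-prefix-zero w
  disjoint-prefix-zero (false ∷ w) = disjoint-prefix-zero w

  -- given agreement on the first k bits, whether bit k settles x ≤ i (for k = n: whether x = i)
  settles : ∀ {n} → Fin (suc n) → BitStr n → BitStr n → Bool
  settles {zero} zero [] [] = true
  settles {suc n} zero (a ∷ x) (b ∷ i) = b ∧ not a
  settles {suc n} (suc k) (a ∷ x) (b ∷ i) = settles k x i

  val< : ∀ {n} (x : BitStr n) → val x ℕ.< 2 ℕ.^ n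
  val< [] = ℕ.s≤s ℕ.z≤n
  val< {suc n} (true ∷ x) = ℕ.≤-trans (ℕ.+-monoʳ-< (2 ℕ.^ n) (val< x)) (ℕ.≤-reflexive (cong (2 ℕ.^ n ℕ.+_) (sym (ℕ.+-identityʳ _))))
  val< {suc n} (false ∷ x) = ℕ.≤-trans (val< x) (ℕ.m≤m+n _ _)

  bitℚ-∧ : ∀ a b → bitℚ (a ∧ b) ≡ bitℚ a * bitℚ b
  bitℚ-∧ true b = sym (*-identityˡ (bitℚ b))
  bitℚ-∧ false b = sym (*-zeroˡ (bitℚ b))

  GT-∷ : ∀ {n} a b (x i : BitStr n) → GT (b ∷ i) (a ∷ x) ≡ bitℚ (b ∧ not a) + bitℚ (not (a xor b)) * GT i x
  GT-∷ false false x i = sym (trans (+-identityˡ _) (*-identityˡ (GT i x)))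
  GT-∷ {n} true true x i = begin
    (if 2 ℕ.^ n ℕ.+ val x ≤ᵇ 2 ℕ.^ n ℕ.+ val i then 1ℚ else 0ℚ) ≡⟨ cong (if_then 1ℚ else 0ℚ) (≤ᵇ-+-cancelˡ (2 ℕ.^ n) (val x) (val i)) ⟩
    GT i x                                                       ≡⟨ trans (+-identityˡ _) (*-identityˡ (GT i x)) ⟨
    0ℚ + 1ℚ * GT i x                                             ∎
    where open ≡-Reasoning
          ≤ᵇ-+-cancelˡ : ∀ a m n → (a ℕ.+ m ≤ᵇ a ℕ.+ n) ≡ (m ≤ᵇ n)
          ≤ᵇ-+-cancelˡ zero m n = refl
          ≤ᵇ-+-cancelˡ (suc a) m n = trans (≤ᵇ-suc (a ℕ.+ m) (a ℕ.+ n)) (≤ᵇ-+-cancelˡ a m n)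
            where ≤ᵇ-suc : ∀ p q → (suc p ≤ᵇ suc q) ≡ (p ≤ᵇ q)
                  ≤ᵇ-suc zero q = refl
                  ≤ᵇ-suc (suc p) q = refl
  GT-∷ {n} false true x i = begin
    (if val x ≤ᵇ 2 ℕ.^ n ℕ.+ val i then 1ℚ else 0ℚ) ≡⟨ cong (if_then 1ℚ else 0ℚ) x≤2^n+i ⟩
    1ℚ                                               ≡⟨ trans (cong (1ℚ +_) (*-zeroˡ (GT i x))) (+-identityʳ 1ℚ) ⟨
    1ℚ + 0ℚ * GT i x                                 ∎
    where open ≡-Reasoning
          x≤2^n+i = dec-true (val x ≤? 2 ℕ.^ n ℕ.+ val i) (ℕ.≤-trans (ℕ.<⇒≤ (val< x)) (ℕ.m≤m+n _ _))
  GT-∷ {n} true false x i = begin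
    (if 2 ℕ.^ n ℕ.+ val x ≤ᵇ val i then 1ℚ else 0ℚ) ≡⟨ cong (if_then 1ℚ else 0ℚ) ¬2^n+x≤i ⟩
    0ℚ                                               ≡⟨ trans (+-identityˡ _) (*-zeroˡ (GT i x)) ⟨
    0ℚ + 0ℚ * GT i x                                 ∎
    where open ≡-Reasoning
          ¬2^n+x≤i = dec-false (2 ℕ.^ n ℕ.+ val x ≤? val i) (ℕ.<⇒≱ (ℕ.≤-trans (val< i) (ℕ.m≤m+n _ _)))

  GT-decomposition : ∀ {n} (i x : BitStr n) →
    GT i x ≡ ∑ (λ k → bitℚ (disjoint (x ⊕ i) (prefix k)) * bitℚ (settles k x i))
  GT-decomposition [] [] = refl
  GT-decomposition (b ∷ i) (a ∷ x) = begin
    GT (b ∷ i) (a ∷ x)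
      ≡⟨ GT-∷ a b x i ⟩
    bitℚ (b ∧ not a) + bitℚ (not (a xor b)) * GT i x
      ≡⟨ cong₂ _+_ (*-identityˡ (bitℚ (b ∧ not a))) (cong (bitℚ (not (a xor b)) *_) (sym (GT-decomposition i x))) ⟨
    1ℚ * bitℚ (b ∧ not a) + bitℚ (not (a xor b)) * ∑ (λ k → T k x i)
      ≡⟨ cong₂ _+_ (cong (λ z → bitℚ z * bitℚ (b ∧ not a)) (disjoint-prefix-zero ((a ∷ x) ⊕ (b ∷ i))))
                   (∑-*ˡ (bitℚ (not (a xor b))) (λ k → T k x i)) ⟨
    T zero (a ∷ x) (b ∷ i) + ∑ (λ k → bitℚ (not (a xor b)) * T k x i)
      ≡⟨ cong (T zero (a ∷ x) (b ∷ i) +_)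
              (∑-cong λ k → *-assoc (bitℚ (not (a xor b))) (bitℚ (disjoint (x ⊕ i) (prefix k))) (bitℚ (settles k x i))) ⟨
    T zero (a ∷ x) (b ∷ i) + ∑ (λ k → bitℚ (not (a xor b)) * bitℚ (disjoint (x ⊕ i) (prefix k)) * bitℚ (settles k x i))
      ≡⟨ cong (T zero (a ∷ x) (b ∷ i) +_)
              (∑-cong λ k → cong (_* bitℚ (settles k x i)) (bitℚ-∧ (not (a xor b)) (disjoint (x ⊕ i) (prefix k)))) ⟨
    T zero (a ∷ x) (b ∷ i) + ∑ (λ k → bitℚ (not (a xor b) ∧ disjoint (x ⊕ i) (prefix k)) * bitℚ (settles k x i))
      ≡⟨ cong (λ c → T zero (a ∷ x) (b ∷ i) + ∑ (λ k → bitℚ (not c ∧ disjoint (x ⊕ i) (prefix k)) * bitℚ (settles k x i)))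
              (∧-identityʳ (a xor b)) ⟨
    ∑ (λ k → T k (a ∷ x) (b ∷ i)) ∎
    where open ≡-Reasoning
          open import Data.Bool.Properties using (∧-identityʳ)
          T : ∀ {m} → Fin (suc m) → BitStr m → BitStr m → ℚ
          T k x i = bitℚ (disjoint (x ⊕ i) (prefix k)) * bitℚ (settles k x i)

  ∈-allBits : ∀ {n} (w : BitStr n) → w ∈ allBits n
  ∈-allBits [] = here refl
  ∈-allBits {suc n} (false ∷ w) = ∈-++⁺ˡ (∈-map⁺ (false ∷_) (∈-allBits w))
  ∈-allBits {suc n} (true ∷ w) = ∈-++⁺ʳ (map (false ∷_) (allBits n)) (∈-map⁺ (true ∷_) (∈-allBits w))

  length-allBits : ∀ n → length (allBits n) ≡ 2 ℕ.^ n
  length-allBits zero = refl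
  length-allBits (suc n) = begin
    length (map (false ∷_) (allBits n) Data.List.++ map (true ∷_) (allBits n))
      ≡⟨ List.length-++ (map (false ∷_) (allBits n)) ⟩
    length (map (false ∷_) (allBits n)) ℕ.+ length (map (true ∷_) (allBits n))
      ≡⟨ cong₂ ℕ._+_ (List.length-map (false ∷_) (allBits n)) (List.length-map (true ∷_) (allBits n)) ⟩
    length (allBits n) ℕ.+ length (allBits n)
      ≡⟨ cong₂ ℕ._+_ (length-allBits n) (trans (length-allBits n) (sym (ℕ.+-identityʳ _))) ⟩
    2 ℕ.^ n ℕ.+ (2 ℕ.^ n ℕ.+ 0) ∎
    where open ≡-Reasoning

module Construction (n t p : ℕ) .{{_ : NonZero t}} where
  open import Data.Bool using (Bool; true; false; not; _xor_; T)
  open import Data.Bool.ListAction using (any)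
  open import Data.Empty using (⊥-elim)
  open import Data.Nat as ℕ using (zero; suc)
  import Data.Nat.Properties as ℕ
  open import Data.Fin using (Fin; zero; suc; _↑ˡ_; _↑ʳ_; combine)
  open import Data.List as List using ([]; _++_; concat; length)
  import Data.List.Properties as List
  open import Data.List.Relation.Unary.All using ([])
  import Data.List.Relation.Unary.All.Properties as All
  open import Data.List.Membership.Propositional using (lose)
  open import Data.List.Membership.Propositional.Properties using (∈-allFin)
  open import Data.List.Relation.Unary.Any using (satisfied)
  open import Data.List.Relation.Unary.Any.Properties using (any⁺; any⁻)
  open import Data.Product using (_,_; proj₁; proj₂)
  open import Data.Vec using (Vec; []; _∷_; lookup; replicate; tabulate) renaming (_++_ to _++ᵥ_; concat to concatᵥ)
  import Data.Vec.Properties as Vec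
  open import Data.Rational using (ℚ; 0ℚ; 1ℚ; _+_; _*_; -_; _-_; ∣_∣; _≤_; ½)
  import Data.Rational.Properties as ℚₚ
  open ℚₚ using (+-identityˡ; +-identityʳ; *-zeroʳ; nonNegative⁻¹; module ≤-Reasoning)
  open import Relation.Binary.PropositionalEquality
  open import Relation.Nullary using (¬_; Dec; does; yes; no; _because_)
  open import Relation.Nullary.Decidable using (T?)
  open import Relation.Nullary.Reflects using (invert)
  open import Defs
  open Counting
  open Products using (blocks; lookup-blocks; atMostFraction-block; length-products-positive)
  open Deviation
  open Arithmetic
  open Polynomials
  open Estimates
  open BitStrings

  L m' : ℕ
  L = 4 ℕ.* t
  m' = suc n ℕ.* L

  -- r = (1_1, …, 1_n, block 0, …, block n), where block k holds L samples from R^(prefix k);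
  -- so the first n bits of Y(r, x) are the bits of x
  templateBlocks : Vec (Vec (BitStr n) L) (suc n)
  templateBlocks = tabulate (λ k → replicate L (prefix k))

  templates : Vec (BitStr n) m'
  templates = concatᵥ templateBlocks

  block : Fin (suc n) → Vec (BitStr n) m' → Vec (BitStr n) L
  block k s = lookup (blocks (suc n) s) k

  xVar : Fin n → Fin (n ℕ.+ m')
  xVar j = j ↑ˡ m'

  blockVar : Fin (suc n) → Fin L → Fin (n ℕ.+ m')
  blockVar k j = n ↑ʳ combine k j

  u : ℚ
  u = reciprocal (2 ℕ.* t) {{ℕ.m*n≢0 2 t}}

  -- since ⟨r_v, x ⊕ i⟩ = y_v ⊕ ⟨r_v, i⟩, this evaluates at y = Y(r, x) to 1 - u · #{j : ⟨r_(k,j), x ⊕ i⟩ = 1}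
  agreementPoly : Vec (BitStr n) (n ℕ.+ m') → BitStr n → Fin (suc n) → Poly (n ℕ.+ m')
  agreementPoly r i k =
    constant 1ℚ ++ scale (- u) (concat (List.tabulate (λ j → literal (blockVar k j) (dot (lookup r (blockVar k j)) i))))

  settlesPoly : ∀ {l} → (Fin l → Fin (n ℕ.+ m')) → Fin (suc l) → BitStr l → Poly (n ℕ.+ m')
  settlesPoly {zero} ρ zero [] = constant 1ℚ
  settlesPoly {suc l} ρ zero (true ∷ i) = literal (ρ zero) true
  settlesPoly {suc l} ρ zero (false ∷ i) = []
  settlesPoly {suc l} ρ (suc k) (b ∷ i) = settlesPoly (λ j → ρ (suc j)) k i

  q : Vec (BitStr n) (n ℕ.+ m') → BitStr n → Poly (n ℕ.+ m')
  q r i = concat (List.tabulate (λ k → mul (pow (agreementPoly r i k) p) (settlesPoly xVar k i)))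

  degree-settlesPoly : ∀ {l} (ρ : Fin l → Fin (n ℕ.+ m')) k i → DegreeAtMost 1 (settlesPoly ρ k i)
  degree-settlesPoly {zero} ρ zero [] = degree-constant 1ℚ
  degree-settlesPoly {suc l} ρ zero (true ∷ i) = degree-literal (ρ zero) true
  degree-settlesPoly {suc l} ρ zero (false ∷ i) = []
  degree-settlesPoly {suc l} ρ (suc k) (b ∷ i) = degree-settlesPoly (λ j → ρ (suc j)) k i

  degree-agreementPoly : ∀ r i k → DegreeAtMost 1 (agreementPoly r i k)
  degree-agreementPoly r i k = degree-++ (degree-constant 1ℚ) (degree-scale (- u) (degree-concat (All.tabulate⁺ λ j →
    degree-literal (blockVar k j) (dot (lookup r (blockVar k j)) i))))

  degree-q : ∀ r i → DegreeAtMost (p ℕ.+ 1) (q r i)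
  degree-q r i = degree-concat (All.tabulate⁺ λ k →
    degree-mul (degree-pow p (degree-agreementPoly r i k)) (degree-settlesPoly xVar k i))

  ∑-bitℚ-dot : ∀ {l} (w : BitStr n) (B : Vec (BitStr n) l) → ∑ (λ j → bitℚ (dot (lookup B j) w)) ≡ toℚ (parityCount true w B)
  ∑-bitℚ-dot w [] = refl
  ∑-bitℚ-dot w (v ∷ B) with dot v w
  ... | true = cong (1ℚ +_) (∑-bitℚ-dot w B)
  ... | false = trans (+-identityˡ _) (∑-bitℚ-dot w B)

  eval-settlesPoly : ∀ {l} (ρ : Fin l → Fin (n ℕ.+ m')) k i x (y : BitStr (n ℕ.+ m')) →
    (∀ j → lookup y (ρ j) ≡ lookup x j) → eval (settlesPoly ρ k i) y ≡ bitℚ (settles k x i)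
  eval-settlesPoly {zero} ρ zero [] [] y _ = eval-constant y 1ℚ
  eval-settlesPoly {suc l} ρ zero (true ∷ i) (a ∷ x) y y∘ρ≡x =
    trans (eval-literal y (ρ zero) true) (cong bitℚ (trans (cong (_xor true) (y∘ρ≡x zero)) (xor-true a)))
    where xor-true : ∀ a → a xor true ≡ not a
          xor-true true = refl
          xor-true false = refl
  eval-settlesPoly {suc l} ρ zero (false ∷ i) (a ∷ x) y _ = refl
  eval-settlesPoly {suc l} ρ (suc k) (b ∷ i) (a ∷ x) y y∘ρ≡x =
    eval-settlesPoly (λ j → ρ (suc j)) k i x y (λ j → y∘ρ≡x (suc j))

  Typical : Vec (BitStr n) m' → Set
  Typical s = ∀ k w → ¬ T (Deviates t w (prefix k) (block k s))

  module Evaluation (s : Vec (BitStr n) m') (i x : BitStr n) where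
    r : Vec (BitStr n) (n ℕ.+ m')
    r = units n ++ᵥ s

    y : BitStr (n ℕ.+ m')
    y = Y r x

    E : Fin (suc n) → ℚ
    E k = 1ℚ + - u * toℚ (parityCount true (x ⊕ i) (block k s))

    lookup-Y : ∀ v → lookup y v ≡ dot (lookup r v) x
    lookup-Y v = Vec.lookup-map v (λ rv → dot rv x) r

    lookup-Y-xVar : ∀ j → lookup y (xVar j) ≡ lookup x j
    lookup-Y-xVar j = begin
      lookup y (xVar j)           ≡⟨ lookup-Y (xVar j) ⟩
      dot (lookup r (xVar j)) x   ≡⟨ cong (λ v → dot v x) (Vec.lookup-++ˡ (units n) s j) ⟩
      dot (lookup (units n) j) x  ≡⟨ cong (λ v → dot v x) (Vec.lookup∘tabulate unitVec j) ⟩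
      dot (unitVec j) x           ≡⟨ dot-unitVec j x ⟩
      lookup x j                  ∎
      where open ≡-Reasoning

    lookup-r-blockVar : ∀ k j → lookup r (blockVar k j) ≡ lookup (block k s) j
    lookup-r-blockVar k j = trans (Vec.lookup-++ʳ (units n) s (combine k j)) (sym (lookup-blocks (suc n) s k j))

    eval-agreementPoly : ∀ k → eval (agreementPoly r i k) y ≡ E k
    eval-agreementPoly k = begin
      eval (agreementPoly r i k) y
        ≡⟨ eval-++ y (constant 1ℚ) (scale (- u) (concat (List.tabulate ℓ))) ⟩
      eval (constant 1ℚ) y + eval (scale (- u) (concat (List.tabulate ℓ))) y
        ≡⟨ cong₂ _+_ (eval-constant y 1ℚ) (eval-scale y (- u) (concat (List.tabulate ℓ))) ⟩
      1ℚ + - u * eval (concat (List.tabulate ℓ)) y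
        ≡⟨ cong (λ z → 1ℚ + - u * z) (eval-concat-tabulate y ℓ) ⟩
      1ℚ + - u * ∑ (λ j → eval (ℓ j) y)
        ≡⟨ cong (λ z → 1ℚ + - u * z) (∑-cong eval-ℓ) ⟩
      1ℚ + - u * ∑ (λ j → bitℚ (dot (lookup (block k s) j) (x ⊕ i)))
        ≡⟨ cong (λ z → 1ℚ + - u * z) (∑-bitℚ-dot (x ⊕ i) (block k s)) ⟩
      E k ∎
      where
      open ≡-Reasoning
      ℓ : Fin L → Poly (n ℕ.+ m')
      ℓ j = literal (blockVar k j) (dot (lookup r (blockVar k j)) i)
      eval-ℓ : ∀ j → eval (ℓ j) y ≡ bitℚ (dot (lookup (block k s) j) (x ⊕ i))
      eval-ℓ j = trans (eval-literal y (blockVar k j) (dot (lookup r (blockVar k j)) i)) (cong bitℚ (begin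
        lookup y (blockVar k j) xor dot (lookup r (blockVar k j)) i
          ≡⟨ cong (_xor dot (lookup r (blockVar k j)) i) (lookup-Y (blockVar k j)) ⟩
        dot (lookup r (blockVar k j)) x xor dot (lookup r (blockVar k j)) i
          ≡⟨ cong (λ v → dot v x xor dot v i) (lookup-r-blockVar k j) ⟩
        dot (lookup (block k s) j) x xor dot (lookup (block k s) j) i
          ≡⟨ dot-⊕ (lookup (block k s) j) x i ⟨
        dot (lookup (block k s) j) (x ⊕ i) ∎))

    eval-q : eval (q r i) y ≡ ∑ (λ k → E k ^ p * bitℚ (settles k x i))
    eval-q = trans (eval-concat-tabulate y (λ k → mul (pow (agreementPoly r i k) p) (settlesPoly xVar k i))) (∑-cong λ k → begin
      eval (mul (pow (agreementPoly r i k) p) (settlesPoly xVar k i)) y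
        ≡⟨ eval-mul y (pow (agreementPoly r i k) p) (settlesPoly xVar k i) ⟩
      eval (pow (agreementPoly r i k) p) y * eval (settlesPoly xVar k i) y
        ≡⟨ cong₂ _*_ (trans (eval-pow y (agreementPoly r i k) p) (cong (_^ p) (eval-agreementPoly k)))
                     (eval-settlesPoly xVar k i x y lookup-Y-xVar) ⟩
      E k ^ p * bitℚ (settles k x i) ∎)
      where open ≡-Reasoning

    ∣E^p-agreement∣≤½^p : Typical s → ∀ k → ∣ E k ^ p - bitℚ (disjoint (x ⊕ i) (prefix k)) ∣ ≤ ½ ^ p
    ∣E^p-agreement∣≤½^p typical k with disjoint (x ⊕ i) (prefix k) in disj
    ... | true = begin
      ∣ E k ^ p - 1ℚ ∣ ≡⟨ cong (λ z → ∣ z ^ p - 1ℚ ∣) E≡1 ⟩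
      ∣ 1ℚ ^ p - 1ℚ ∣  ≡⟨ cong (λ z → ∣ z - 1ℚ ∣) (1^p≡1 p) ⟩
      0ℚ              ≤⟨ nonNegative⁻¹ (½ ^ p) {{½^-nonNeg p}} ⟩
      ½ ^ p           ∎
      where
      open ≤-Reasoning
      E≡1 : E k ≡ 1ℚ
      E≡1 = begin-equality
        E k                 ≡⟨ cong (λ c → 1ℚ + - u * toℚ c) c≡0 ⟩
        1ℚ + - u * 0ℚ       ≡⟨ cong (1ℚ +_) (*-zeroʳ (- u)) ⟩
        1ℚ + 0ℚ             ≡⟨ +-identityʳ 1ℚ ⟩
        1ℚ                  ∎
        where c≡0 = ¬Deviates⇒parityCount≡0 t (x ⊕ i) (prefix k) (block k s) disj (typical k (x ⊕ i))
    ... | false = begin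
      ∣ E k ^ p - 0ℚ ∣ ≡⟨ cong ∣_∣ (+-identityʳ (E k ^ p)) ⟩
      ∣ E k ^ p ∣      ≤⟨ ∣x^p∣≤½^p p (∣1-u*c∣≤½ t _ 0≤u (toℚ-*-reciprocal-2* t) t≤c c≤3t) ⟩
      ½ ^ p            ∎
      where
      open ≤-Reasoning
      0≤u = reciprocal-nonNeg (2 ℕ.* t) {{ℕ.m*n≢0 2 t}}
      bounds = ¬Deviates⇒balanced t (x ⊕ i) (prefix k) (block k s) disj (typical k (x ⊕ i))
      t≤c = proj₁ bounds
      c≤3t = proj₂ bounds

    approximation : Typical s → 6 ℕ.* suc n ℕ.≤ 2 ℕ.^ p → ∣ eval (q r i) y - GT i x ∣ ≤ oneSixth
    approximation typical 6[n+1]≤2^p = begin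
      ∣ eval (q r i) y - GT i x ∣
        ≡⟨ cong₂ (λ a b → ∣ a - b ∣) eval-q (GT-decomposition i x) ⟩
      ∣ ∑ (λ k → E k ^ p * bitℚ (settles k x i)) - ∑ (λ k → A k * bitℚ (settles k x i)) ∣
        ≡⟨ cong ∣_∣ (∑-- (λ k → E k ^ p * bitℚ (settles k x i)) (λ k → A k * bitℚ (settles k x i))) ⟩
      ∣ ∑ (λ k → E k ^ p * bitℚ (settles k x i) - A k * bitℚ (settles k x i)) ∣
        ≤⟨ ∣∑∣≤ _ (½ ^ p) term-bound ⟩
      toℚ (suc n) * ½ ^ p
        ≤⟨ toℚ*½^p≤⅙ (suc n) p 6[n+1]≤2^p ⟩
      oneSixth ∎
      where
      open ≤-Reasoning
      A : Fin (suc n) → ℚ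
      A k = bitℚ (disjoint (x ⊕ i) (prefix k))
      term-bound : ∀ k → ∣ E k ^ p * bitℚ (settles k x i) - A k * bitℚ (settles k x i) ∣ ≤ ½ ^ p
      term-bound k = begin
        ∣ E k ^ p * bitℚ (settles k x i) - A k * bitℚ (settles k x i) ∣ ≡⟨ cong ∣_∣ (*-distribʳ-- (E k ^ p) (A k) _) ⟩
        ∣ (E k ^ p - A k) * bitℚ (settles k x i) ∣                      ≤⟨ ∣x*bitℚ∣≤∣x∣ (E k ^ p - A k) (settles k x i) ⟩
        ∣ E k ^ p - A k ∣                                               ≤⟨ ∣E^p-agreement∣≤½^p typical k ⟩
        ½ ^ p                                                           ∎

  Atypical : Vec (BitStr n) m' → Bool
  Atypical s = any (λ k → any (λ w → Deviates t w (prefix k) (block k s)) (allBits n)) (List.allFin (suc n))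

  ¬atypical⇒typical : ∀ s → ¬ T (Atypical s) → Typical s
  ¬atypical⇒typical s ¬atypical k w deviates =
    ¬atypical (any⁺ _ (lose (∈-allFin k) (any⁺ _ (lose (∈-allBits w) deviates))))

  bad⇒atypical : 6 ℕ.* suc n ℕ.≤ 2 ℕ.^ p → ∀ s → T (bad q (units n ++ᵥ s)) → T (Atypical s)
  bad⇒atypical 6[n+1]≤2^p s isBad with T? (Atypical s)
  ... | yes atypical = atypical
  ... | no ¬atypical =
    let i , isBadᵢ = satisfied (any⁻ (λ i → any (tooFar i) (allBits n)) (allBits n) isBad)
        x , isBadᵢₓ = satisfied (any⁻ (tooFar i) (allBits n) isBadᵢ)
        open Evaluation s i x using (approximation)
    in ⊥-elim (ℚₚ.<-irrefl refl (ℚₚ.<-≤-trans (T-does⇒ (oneSixth ℚₚ.<? _) isBadᵢₓ)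
                                             (approximation (¬atypical⇒typical s ¬atypical) 6[n+1]≤2^p)))
    where
    r = units n ++ᵥ s
    tooFar : BitStr n → BitStr n → Bool
    tooFar i x = does (oneSixth ℚₚ.<? ∣ eval (q r i) (Y r x) - GT i x ∣)
    T-does⇒ : ∀ {A : Set} (a? : Dec A) → T (does a?) → A
    T-does⇒ (true because [a]) _ = invert [a]

  atypical-fraction : AtMostFraction (suc n ℕ.* (2 ℕ.^ n ℕ.* (2 ℕ.* 16 ℕ.^ t))) (27 ℕ.^ t) Atypical (products templates)
  atypical-fraction =
    subst (λ e → AtMostFraction e (27 ℕ.^ t) Atypical (products templates))
      (cong₂ ℕ._*_ (List.length-tabulate {n = suc n} (λ k → k)) (cong (ℕ._* (2 ℕ.* 16 ℕ.^ t)) (length-allBits n)))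
      (atMostFraction-any (λ k s → any (λ w → Deviates t w (prefix k) (block k s)) (allBits n)) (List.allFin (suc n)) λ k →
        atMostFraction-any (λ w s → Deviates t w (prefix k) (block k s)) (allBits n) λ w →
          atMostFraction-block templateBlocks k (Deviates t w (prefix k))
            (subst (λ τs → AtMostFraction (2 ℕ.* 16 ℕ.^ t) (27 ℕ.^ t) (Deviates t w (prefix k)) (products τs))
                   (sym (Vec.lookup∘tabulate (λ k → replicate L (prefix k)) k)) (deviation-bound t w (prefix k))))

  badCount-bound : 6 ℕ.* suc n ℕ.≤ 2 ℕ.^ p → 3 ℕ.* (suc n ℕ.* (2 ℕ.^ n ℕ.* (2 ℕ.* 16 ℕ.^ t))) ℕ.< 27 ℕ.^ t →
    3 ℕ.* badCount templates q ℕ.< length (goodBase templates)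
  badCount-bound 6[n+1]≤2^p 3e<d = subst₂ (λ a b → 3 ℕ.* a ℕ.< b) (sym count≡) (sym (List.length-map (units n ++ᵥ_) Ps))
    (atMostFraction⇒count< 3 3e<d (length-products-positive templates)
      (atMostFraction-mono (bad⇒atypical 6[n+1]≤2^p) atypical-fraction))
    where
    Ps = products templates
    count≡ : badCount templates q ≡ count (λ s → bad q (units n ++ᵥ s)) Ps
    count≡ = trans (length-filter-T? (bad q) (goodBase templates)) (count-map (bad q) (units n ++ᵥ_) Ps)

module Numerics where
  open import Data.Nat
  open import Data.Nat.Properties
  open import Data.Nat.Logarithm
  open import Data.Nat.Induction using (<-wellFounded)
  open import Data.Nat.Tactic.RingSolver using (solve-∀)
  open import Induction.WellFounded using (Acc; acc)
  open import Relation.Binary.PropositionalEquality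
  open Counting using (^-distribʳ-*)

  1≤⌈log₂⌉ : ∀ {n} → 2 ≤ n → 1 ≤ ⌈log₂ n ⌉
  1≤⌈log₂⌉ 2≤n = ⌈log₂⌉-mono-≤ 2≤n

  n≤2^⌈log₂n⌉ : ∀ n → n ≤ 2 ^ ⌈log₂ n ⌉
  n≤2^⌈log₂n⌉ n = go n (<-wellFounded n)
    where
    go : ∀ n → Acc _<_ n → n ≤ 2 ^ ⌈log₂ n ⌉
    go zero _ = z≤n
    go (suc zero) _ = ≤-refl
    go n@(suc (suc m)) (acc rec) = begin
      n                           ≡⟨ ⌊n/2⌋+⌈n/2⌉≡n n ⟨
      ⌊ n /2⌋ + ⌈ n /2⌉           ≤⟨ +-monoˡ-≤ ⌈ n /2⌉ (⌊n/2⌋≤⌈n/2⌉ n) ⟩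
      ⌈ n /2⌉ + ⌈ n /2⌉           ≤⟨ +-mono-≤ IH IH ⟩
      2 ^ ⌈log₂ ⌈ n /2⌉ ⌉ + 2 ^ ⌈log₂ ⌈ n /2⌉ ⌉ ≡⟨ cong (λ e → 2 ^ e + 2 ^ e) (⌈log₂⌈n/2⌉⌉≡⌈log₂n⌉∸1 n) ⟩
      2 ^ (⌈log₂ n ⌉ ∸ 1) + 2 ^ (⌈log₂ n ⌉ ∸ 1) ≡⟨ cong (2 ^ (⌈log₂ n ⌉ ∸ 1) +_) (+-identityʳ _) ⟨
      2 ^ suc (⌈log₂ n ⌉ ∸ 1)     ≡⟨ cong (2 ^_) (m+[n∸m]≡n (1≤⌈log₂⌉ {n} (s≤s (s≤s z≤n)))) ⟩
      2 ^ ⌈log₂ n ⌉               ∎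
      where open ≤-Reasoning
            IH = go ⌈ n /2⌉ (rec (s≤s (⌊n/2⌋<n m)))

  6[n+1]≤2^[⌈log₂n⌉+4] : ∀ {n} → 1 ≤ n → 6 * suc n ≤ 2 ^ (⌈log₂ n ⌉ + 4)
  6[n+1]≤2^[⌈log₂n⌉+4] {n} 1≤n = begin
    6 * suc n            ≤⟨ *-monoʳ-≤ 6 (+-monoˡ-≤ n 1≤n) ⟩
    6 * (n + n)          ≤⟨ *-monoˡ-≤ (n + n) (≤ᵇ⇒≤ 6 8 _) ⟩
    8 * (n + n)          ≡⟨ rearrange n ⟩
    n * 16               ≤⟨ *-monoˡ-≤ 16 (n≤2^⌈log₂n⌉ n) ⟩
    2 ^ ⌈log₂ n ⌉ * 16   ≡⟨ ^-distribˡ-+-* 2 ⌈log₂ n ⌉ 4 ⟨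
    2 ^ (⌈log₂ n ⌉ + 4)  ∎
    where open ≤-Reasoning
          rearrange : ∀ n → 8 * (n + n) ≡ n * 16
          rearrange = solve-∀

  degree-bound : ∀ {l} → 1 ≤ l → l + 4 + 1 ≤ 25 * l
  degree-bound {l} 1≤l = begin
    l + 4 + 1   ≡⟨ +-assoc l 4 1 ⟩
    l + 5 * 1   ≤⟨ +-monoʳ-≤ l (*-monoʳ-≤ 5 1≤l) ⟩
    l + 5 * l   ≤⟨ +-monoʳ-≤ l (*-monoˡ-≤ l (≤ᵇ⇒≤ 5 24 _)) ⟩
    l + 24 * l  ∎
    where open ≤-Reasoning

  size-bound : ∀ {n l} → 1 ≤ n → 1 ≤ l → n + suc n * (4 * (3 * n)) ≤ 25 * n ^ 3 * l
  size-bound {n} {l} 1≤n 1≤l = begin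
    n + suc n * (4 * (3 * n))          ≡⟨ expand n ⟩
    13 * n + 12 * (n * n)              ≤⟨ +-monoˡ-≤ (12 * (n * n)) (*-monoʳ-≤ 13 (m≤m*n n n {{>-nonZero 1≤n}})) ⟩
    13 * (n * n) + 12 * (n * n)        ≡⟨ *-distribʳ-+ (n * n) 13 12 ⟨
    25 * (n * n)                       ≡⟨ *-identityʳ _ ⟨
    25 * (n * n) * 1                   ≤⟨ *-monoʳ-≤ (25 * (n * n)) (*-mono-≤ 1≤n 1≤l) ⟩
    25 * (n * n) * (n * l)             ≡⟨ regroup n l ⟩
    25 * n ^ 3 * l                     ∎
    where open ≤-Reasoning
          expand : ∀ n → n + suc n * (4 * (3 * n)) ≡ 13 * n + 12 * (n * n)
          expand = solve-∀
          regroup : ∀ n l → 25 * (n * n) * (n * l) ≡ 25 * (n * (n * (n * 1))) * l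
          regroup = solve-∀

  6[5+k]8192^[4+k]<19683^[4+k] : ∀ k → 6 * suc (4 + k) * 8192 ^ (4 + k) < 19683 ^ (4 + k)
  6[5+k]8192^[4+k]<19683^[4+k] zero = ≤ᵇ⇒≤ _ _ _
  6[5+k]8192^[4+k]<19683^[4+k] (suc k) = begin-strict
    6 * suc (5 + k) * 8192 ^ (5 + k)                        ≡⟨ expand (suc (4 + k)) (8192 ^ (4 + k)) ⟩
    8192 * X + 8192 * (6 * 8192 ^ (4 + k))
      ≤⟨ +-monoʳ-≤ (8192 * X) (*-monoʳ-≤ 8192 (*-monoˡ-≤ (8192 ^ (4 + k)) (*-monoʳ-≤ 6 (s≤s (z≤n {4 + k}))))) ⟩
    8192 * X + 8192 * X                                     ≡⟨ *-distribʳ-+ X 8192 8192 ⟨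
    16384 * X                                               <⟨ *-monoʳ-< 16384 (6[5+k]8192^[4+k]<19683^[4+k] k) ⟩
    16384 * 19683 ^ (4 + k)                                 ≤⟨ *-monoˡ-≤ (19683 ^ (4 + k)) (≤ᵇ⇒≤ 16384 19683 _) ⟩
    19683 ^ (5 + k)                                         ∎
    where open ≤-Reasoning
          X = 6 * suc (4 + k) * 8192 ^ (4 + k)
          expand : ∀ a b → 6 * suc a * (8192 * b) ≡ 8192 * (6 * a * b) + 8192 * (6 * b)
          -- stated through 1 + a because checking the solver's proof against suc a is very slow
          expand a b = expand′ a b
            where expand′ : ∀ a b → 6 * (1 + a) * (8192 * b) ≡ 8192 * (6 * a * b) + 8192 * (6 * b)
                  expand′ = solve-∀

  tail-bound : ∀ {n} → 4 ≤ n → 3 * (suc n * (2 ^ n * (2 * 16 ^ (3 * n)))) < 27 ^ (3 * n)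
  tail-bound {n@(suc (suc (suc (suc k))))} (s≤s (s≤s (s≤s (s≤s _)))) = begin-strict
    3 * (suc n * (2 ^ n * (2 * 16 ^ (3 * n)))) ≡⟨ cong (λ z → 3 * (suc n * (2 ^ n * (2 * z)))) (^-*-assoc 16 3 n) ⟨
    3 * (suc n * (2 ^ n * (2 * 4096 ^ n)))     ≡⟨ regroup (suc n) (2 ^ n) (4096 ^ n) ⟩
    6 * suc n * (2 ^ n * 4096 ^ n)             ≡⟨ cong (6 * suc n *_) (^-distribʳ-* 2 4096 n) ⟨
    6 * suc n * 8192 ^ n                       <⟨ 6[5+k]8192^[4+k]<19683^[4+k] k ⟩
    19683 ^ n                                  ≡⟨ ^-*-assoc 27 3 n ⟩
    27 ^ (3 * n)                               ∎
    where
    open ≤-Reasoning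
    regroup : ∀ a b c → 3 * (a * (b * (2 * c))) ≡ 6 * a * (b * c)
    regroup = solve-∀

open import Defs
open import Data.Nat using (ℕ; _+_; _*_; _^_; _≤_; _<_; s≤s; z≤n; >-nonZero)
open import Data.Nat.Properties using (≤-trans; m*n≢0)
open import Data.Nat.Logarithm using (⌈log₂_⌉)
open import Data.Vec using (Vec)
open import Data.List using (length)
open import Data.List.Membership.Propositional using (_∈_)
open import Data.Product using (Σ; _×_; ∃-syntax; _,_)
open Polynomials using (degree-weaken)
open Numerics

claim3p2 : ∃[ C ] ∃[ N ] ((n : ℕ) → N ≤ n →
    ∃[ m' ] Σ (Vec (BitStr n) m') λ τs →
      (n + m' ≤ C * n ^ 3 * ⌈log₂ n ⌉)
      × Σ (Vec (BitStr n) (n + m') → BitStr n → Poly (n + m')) λ q →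
          ((r : Vec (BitStr n) (n + m')) → r ∈ goodBase τs →
             (i : BitStr n) → DegreeAtMost (C * ⌈log₂ n ⌉) (q r i))
          × (3 * badCount τs q < length (goodBase τs)))
claim3p2 = 25 , 4 , λ n 4≤n →
  let 1≤n = ≤-trans (s≤s z≤n) 4≤n
      1≤⌈log₂n⌉ = 1≤⌈log₂⌉ (≤-trans (s≤s (s≤s z≤n)) 4≤n)
      open Construction n (3 * n) (⌈log₂ n ⌉ + 4) {{m*n≢0 3 n {{_}} {{>-nonZero 1≤n}}}}
  in m' , templates , size-bound 1≤n 1≤⌈log₂n⌉ , q ,
     (λ r _ i → degree-weaken (degree-bound 1≤⌈log₂n⌉) (degree-q r i)) ,
     badCount-bound (6[n+1]≤2^[⌈log₂n⌉+4] 1≤n) (tail-bound 4≤n)
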